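{- Let $r$ be a rigid expression and $\vec b$ a rigid monomial with $r\asymp r$ and $|\vec b|=n_x(r)$. Then \[\mathrm{Card}(\mathrm{Sub}_x(r,\vec b))=\frac{\mathrm{Card}(\mathbb D(r))\,\mathrm{Card}(\mathbb D(\vec b))}{\mathrm{Card}(\mathbb D(r[\vec b/x]))}.\]
   Context: Rigid terms and monomials: $a,b,c ::= x\mid\lambda x.a\mid\langle a\rangle\vec b\mid a\oplus\bullet\mid\bullet\oplus a$, $\vec b::=(b_1,\dots,b_n)$ (finite lists; $|\vec b|=n$, $::$ concatenation), up to $\alpha$-equivalence; $n_x(r)$ counts free occurrences of $x$. $\mathfrak S_n$ acts on $n$-tuples by $\sigma\cdot(a_1,\dots,a_n)=(a_{\sigma^{ -1}(1)},\dots,a_{\sigma^{ -1}(n)})$. Rigid substitution, for $|\vec b|=n_x(r)$: $x[(b)/x]=b$, $y[()/x]=y$ ($y\ne x$), $(\lambda z.a)[\vec b/x]=\lambda z.a[\vec b/x]$ ($z$ fresh), $(a\oplus\bullet)[\vec b/x]=a[\vec b/x]\oplus\bullet$, $(\bullet\oplus a)[\vec b/x]=\bullet\oplus a[\vec b/x]$, $(\langle c\rangle\vec d)[\vec b_0::\vec b_1/x]=\langle c[\vec b_0/x]\rangle\vec d[\vec b_1/x]$ with $|\vec b_0|=n_x(c)$, $|\vec b_1|=n_x(\vec d)$, $(a_1,\dots,a_n)[\vec b_1::\cdots::\vec b_n/x]=(a_1[\vec b_1/x],\dots,a_n[\vec b_n/x])$ with $|\vec b_i|=n_x(a_i)$.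 Permutation expressions: $\alpha,\gamma ::= \mathrm{id}_x\mid\lambda x.\alpha\mid\langle\gamma\rangle\tilde\delta\mid\alpha\oplus\bullet\mid\bullet\oplus\alpha$, $\tilde\delta::=(\sigma,\alpha_1,\dots,\alpha_n)$ with $\sigma\in\mathfrak S_n$. Judgement $\epsilon:r\cong r'$: $\mathrm{id}_x:x\cong x$; $\lambda x.\alpha:\lambda x.a\cong\lambda x.a'$, $\alpha\oplus\bullet:a\oplus\bullet\cong a'\oplus\bullet$, $\bullet\oplus\alpha:\bullet\oplus a\cong\bullet\oplus a'$ whenever $\alpha:a\cong a'$; $\langle\gamma\rangle\tilde\delta:\langle c\rangle\vec d\cong\langle c'\rangle\vec d'$ whenever $\gamma:c\cong c'$ and $\tilde\delta:\vec d\cong\vec d'$; $(\sigma,\alpha_1,\dots,\alpha_n):(a_1,\dots,a_n)\cong(a'_1,\dots,a'_n)$ whenever $\alpha_i:a_i\cong a'_{\sigma(i)}$ for all $i$. $r\cong r'$ means some $\epsilon:r\cong r'$ exists. $\mathbb D(r)$ is the set of $\epsilon$ with $\epsilon:r\cong r$ (for $r$ a rigid term or a rigid monomial). $\mathrm{Sub}_x(r,\vec b)=\{\sigma\in\mathfrak S_{n_x(r)}\mid r[\vec b/x]\cong r[\sigma\cdot\vec b/x]\}$. Rigid coherence $\asymp$: $x\asymp x$; $\lambda x.a\asymp\lambda x.a'$ if $a\asymp a'$; $\langle c\rangle\vec d\asymp\langle c'\rangle\vec d'$ if $c\asymp c'$ and $\vec d\asymp\vec d'$; $(b_1,\dots,b_n)\asymp(b_{n+1},\dots,b_{n+m})$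 if $b_i\asymp b_j$ for all $1\le i,j\le n+m$; $a\oplus\bullet\asymp a'\oplus\bullet$ and $\bullet\oplus a\asymp\bullet\oplus a'$ if $a\asymp a'$; $a\oplus\bullet\asymp\bullet\oplus a'$ for all $a,a'$ (symmetric). -}

module Defs where

open import Data.Nat using (ℕ; zero; suc; _<ᵇ_; _≡ᵇ_)
open import Data.Bool using (if_then_else_)
open import Data.Fin using (Fin; zero; suc; punchIn)
open import Data.List as List using (List; []; _∷_; take; drop; length)
open import Data.Vec as Vec using (Vec; []; _∷_; lookup; insertAt; _++_)
open import Data.Product using (Σ; _×_; _,_)
open import Data.Empty using (⊥)
open import Relation.Binary.PropositionalEquality using (_≡_)
open import Data.List.Relation.Unary.Unique.Propositional using (Unique)
open import Data.List.Membership.Propositional using (_∈_)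
open import Function.Bundles using (_⇔_)

-- Rigid terms (de Bruijn indices, so terms are literally up to α).
-- A rigid monomial of length n is a  Vec Term n.

data Term : Set where
  var : ℕ → Term
  lam : Term → Term                       -- λ x. a   (binds index 0)
  app : Term → {n : ℕ} → Vec Term n → Term  -- ⟨ c ⟩ (d₁,…,dₙ)
  inl : Term → Term                       -- a ⊕ •
  inr : Term → Term                       -- • ⊕ a

mutual
  nx : ℕ → Term → ℕ
  nx x (var y) = if y ≡ᵇ x then 1 else 0
  nx x (lam a) = nx (suc x) a
  nx x (app c ds) = nx x c Data.Nat.+ nxV x ds
  nx x (inl a) = nx x a
  nx x (inr a) = nx x a

  nxV : ∀ {n} → ℕ → Vec Term n → ℕ
  nxV x [] = 0
  nxV x (d ∷ ds) = nx x d Data.Nat.+ nxV x ds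

mutual
  shift : ℕ → Term → Term
  shift c (var y) = if y <ᵇ c then var y else var (suc y)
  shift c (lam a) = lam (shift (suc c) a)
  shift c (app a ds) = app (shift c a) (shiftV c ds)
  shift c (inl a) = inl (shift c a)
  shift c (inr a) = inr (shift c a)

  shiftV : ∀ {n} → ℕ → Vec Term n → Vec Term n
  shiftV c [] = []
  shiftV c (d ∷ ds) = shift c d ∷ shiftV c ds

-- Total function; it agrees with the paper's
-- (partial) definition whenever |b⃗| = n_x(r), which is the only case used.
mutual
  subst : Term → ℕ → List Term → Term
  subst (var y) x bs = if y ≡ᵇ x then hd bs else var y
    where
    hd : List Term → Term
    hd [] = var y
    hd (b ∷ _) = b
  subst (lam a) x bs = lam (subst a (suc x) (List.map (shift 0) bs))
  subst (app c ds) x bs =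
    app (subst c x (take (nx x c) bs)) (substV ds x (drop (nx x c) bs))
  subst (inl a) x bs = inl (subst a x bs)
  subst (inr a) x bs = inr (subst a x bs)

  substV : ∀ {n} → Vec Term n → ℕ → List Term → Vec Term n
  substV [] x bs = []
  substV (d ∷ ds) x bs = subst d x (take (nx x d) bs) ∷ substV ds x (drop (nx x d) bs)

-- Permutations 𝔖ₙ, in a canonical (Lehmer-code / insertion) encoding:
-- each code denotes exactly one permutation and every permutation
-- has exactly one code, so ≡ on Perm n is equality of permutations.

data Perm : ℕ → Set where
  []  : Perm 0
  _∷_ : ∀ {n} → Fin (suc n) → Perm n → Perm (suc n)

apply : ∀ {n} → Perm n → Fin n → Fin n
apply (i ∷ π) zero = i
apply (i ∷ π) (suc j) = punchIn i (apply π j)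

-- σ · (a₁,…,aₙ) = (a_{σ⁻¹(1)},…,a_{σ⁻¹(n)}), i.e. position σ(i) holds aᵢ
act : ∀ {n} {A : Set} → Perm n → Vec A n → Vec A n
act [] [] = []
act (i ∷ π) (a ∷ as) = insertAt (act π as) i a

data PExpr : Set where
  pid  : ℕ → PExpr
  plam : PExpr → PExpr
  papp : PExpr → (n : ℕ) → Perm n → Vec PExpr n → PExpr
  pinl : PExpr → PExpr
  pinr : PExpr → PExpr

data _∶_≅_ : PExpr → Term → Term → Set where
  pid  : ∀ {x} → pid x ∶ var x ≅ var x
  plam : ∀ {α a a'} → α ∶ a ≅ a' → plam α ∶ lam a ≅ lam a'
  papp : ∀ {γ c c' n σ} {αs : Vec PExpr n} {ds ds' : Vec Term n} →
         γ ∶ c ≅ c' →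
         (∀ i → lookup αs i ∶ lookup ds i ≅ lookup ds' (apply σ i)) →
         papp γ n σ αs ∶ app c ds ≅ app c' ds'
  pinl : ∀ {α a a'} → α ∶ a ≅ a' → pinl α ∶ inl a ≅ inl a'
  pinr : ∀ {α a a'} → α ∶ a ≅ a' → pinr α ∶ inr a ≅ inr a'

TupIso : ∀ {n} → Perm n → Vec PExpr n → Vec Term n → Vec Term n → Set
TupIso σ αs as as' = ∀ i → lookup αs i ∶ lookup as i ≅ lookup as' (apply σ i)

data _≍_ : Term → Term → Set where
  var : ∀ {x} → var x ≍ var x
  lam : ∀ {a a'} → a ≍ a' → lam a ≍ lam a'
  app : ∀ {c c' n m} {ds : Vec Term n} {ds' : Vec Term m} → c ≍ c' →
        (∀ i j → lookup (ds ++ ds') i ≍ lookup (ds ++ ds') j) →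
        app c ds ≍ app c' ds'
  inl : ∀ {a a'} → a ≍ a' → inl a ≍ inl a'
  inr : ∀ {a a'} → a ≍ a' → inr a ≍ inr a'
  inl-inr : ∀ {a a'} → inl a ≍ inr a'
  inr-inl : ∀ {a a'} → inr a ≍ inl a'

data RExpr : Set where
  term : Term → RExpr
  mono : (n : ℕ) → Vec Term n → RExpr

nxR : ℕ → RExpr → ℕ
nxR x (term a) = nx x a
nxR x (mono n ds) = nxV x ds

substR : RExpr → ℕ → List Term → RExpr
substR (term a) x bs = term (subst a x bs)
substR (mono n ds) x bs = mono n (substV ds x bs)

data _≍ᴿ_ : RExpr → RExpr → Set where
  term : ∀ {a a'} → a ≍ a' → term a ≍ᴿ term a'
  mono : ∀ {n m} {ds : Vec Term n} {ds' : Vec Term m} →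
         (∀ i j → lookup (ds ++ ds') i ≍ lookup (ds ++ ds') j) →
         mono n ds ≍ᴿ mono m ds'

PE : RExpr → Set
PE (term _) = PExpr
PE (mono n _) = Perm n × Vec PExpr n

data _≅ᴿ_ : RExpr → RExpr → Set where
  term : ∀ {ε a a'} → ε ∶ a ≅ a' → term a ≅ᴿ term a'
  mono : ∀ {n σ αs} {ds ds' : Vec Term n} → TupIso σ αs ds ds' → mono n ds ≅ᴿ mono n ds'

𝔻 : (r : RExpr) → PE r → Set
𝔻 (term a) ε = ε ∶ a ≅ a
𝔻 (mono n ds) (σ , αs) = TupIso σ αs ds ds

Sub : (x : ℕ) (r : RExpr) → Vec Term (nxR x r) → Perm (nxR x r) → Set
Sub x r bs σ = substR r x (Vec.toList bs) ≅ᴿ substR r x (Vec.toList (act σ bs))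

-- Card {a | P a} = k : the elements satisfying P are exactly those of a
-- duplicate-free list of length k.

HasCard : {A : Set} → (A → Set) → ℕ → Set
HasCard {A} P k = Σ (List A) λ xs → (length xs ≡ k) × Unique xs × (∀ a → (a ∈ xs) ⇔ P a)

-- Write #iso u v for the number of isomorphisms u ≅ v (#isos for
-- tuples); the isomorphisms are enumerated explicitly, so Card 𝔻(u) = #iso u u.
-- (1) Orbit counting: σ ∈ Sub_x(r,b⃗) iff #iso t (tσ) ≠ 0, where t = r[b⃗/x] and
--     tσ = r[σ·b⃗/x], and then #iso t tσ = #iso t t since counts only depend on
--     the isomorphism class; hence Card Sub · #iso t t = ∑_σ #iso t tσ.
-- (2) Counting formula: for coherent s ≍ s', an isomorphism s[b⃗/x] ≅ s'[c⃗/x] is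
--     an isomorphism s ≅ s' together with isomorphisms b_i ≅ c_(π i), where π is
--     the map it induces on occurrences of x; hence
--     #iso s[b⃗/x] s'[c⃗/x] = ∑_π ∏_i #iso b_i c_(π i).
-- (3) Summing (2) over σ and exchanging the sums, each π contributes ∑_σ ∏_i
--     #iso b_i b_(σ⁻¹ π i) = #isos b⃗ b⃗; so ∑_σ #iso t tσ = #iso r r · #isos b⃗ b⃗.
module Submission where

open import Defs
open import Data.Bool using (true; false; if_then_else_; T)
open import Data.Unit using (tt)
open import Data.Empty using (⊥-elim)
open import Data.Nat using (ℕ; zero; suc; _+_; _*_; _≤_; _<_; _<?_; _≟_; _≡ᵇ_; _<ᵇ_; s≤s; z≤n)
import Data.Nat.Properties as ℕ
open import Data.Nat.Properties
  using ( +-commutativeSemigroup; +-identityʳ; *-zeroʳ; *-identityʳ; *-identityˡ; *-assoc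
        ; *-distribʳ-+; *-distribˡ-+; n≤0⇒n≡0; <⇒≢; <ᵇ⇒<; <⇒<ᵇ; ≮⇒≥; <⇒≱; ≤-trans; n≤1+n; ≤-reflexive )
open import Algebra.Properties.CommutativeSemigroup +-commutativeSemigroup
  renaming (interchange to +-interchange)
open import Data.Nat.ListAction using (sum)
open import Data.Nat.ListAction.Properties using (sum-++; sum-↭)
open import Data.Fin using (Fin; zero; suc; punchIn; punchOut; _↑ˡ_; _↑ʳ_)
import Data.Fin as Fin
open import Data.Fin.Properties
  using ( punchIn-injective; punchInᵢ≢i; punchIn-punchOut; punchOut-punchIn; punchOut-injective
        ; 0≢1+n; suc-injective; ↑ˡ-injective; ↑ʳ-injective
        ; splitAt-↑ˡ; splitAt-↑ʳ; splitAt⁻¹-↑ˡ; splitAt⁻¹-↑ʳ )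
open import Data.List as List
  using (List; []; _∷_; _++_; length; concatMap; cartesianProductWith; allFin; filter)
open import Data.List.Properties using (map-++; map-∘; length-map; filter-accept; filter-reject)
open import Data.List.Membership.Propositional using (_∈_; find; lose)
open import Data.List.Membership.Propositional.Properties
  using ( ∈-map⁺; ∈-map⁻; ∈-concatMap⁺; ∈-concatMap⁻; ∈-allFin
        ; ∈-cartesianProductWith⁺; ∈-cartesianProductWith⁻; ∈-filter⁺; ∈-filter⁻ )
open import Data.List.Membership.Propositional.Properties.WithK using (unique∧set⇒bag)
open import Data.List.Relation.Binary.BagAndSetEquality using (∼bag⇒↭)
import Data.List.Relation.Binary.Permutation.Propositional.Properties as ↭
open import Data.List.Relation.Unary.All as All using ([])
open import Data.List.Relation.Unary.Any using (here; there)
open import Data.List.Relation.Unary.AllPairs using ([]; _∷_)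
open import Data.List.Relation.Unary.Unique.Propositional using (Unique)
import Data.List.Relation.Unary.Unique.Propositional.Properties as Unique
open import Data.Vec as Vec using (Vec; []; _∷_; lookup; removeAt; take; drop; toList)
open import Data.Vec.Properties
  using ( insertAt-lookup; insertAt-punchIn; removeAt-punchOut; lookup-++ˡ; lookup-++ʳ; lookup-splitAt
        ; take++drop≡id; ++-injectiveˡ; ++-injectiveʳ; lookup-map; toList-map )
open import Data.Sum using (inj₁; inj₂; [_,_]′)
open import Data.Sum.Properties using ([,]-∘; [,]-cong)
open import Data.Product using (Σ; ∃; _×_; _,_; proj₁; proj₂)
open import Function using (_∘_; id)
open import Function.Bundles using (_⇔_; mk⇔; Equivalence)
open import Function.Definitions using (Injective)
open import Relation.Nullary using (¬_; yes; no)
open import Relation.Binary.PropositionalEquality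
  using (_≡_; _≢_; refl; sym; trans; cong; cong₂; subst₂; module ≡-Reasoning)
  renaming (subst to ≡-subst)

∑ : {A : Set} → List A → (A → ℕ) → ℕ
∑ xs g = sum (List.map g xs)

module _ {A : Set} where

  ∑-cong : ∀ (xs : List A) {g h : A → ℕ} → (∀ x → x ∈ xs → g x ≡ h x) → ∑ xs g ≡ ∑ xs h
  ∑-cong []       e = refl
  ∑-cong (x ∷ xs) e = cong₂ _+_ (e x (here refl)) (∑-cong xs (λ y y∈ → e y (there y∈)))

  ∑-++ : ∀ (xs ys : List A) g → ∑ (xs ++ ys) g ≡ ∑ xs g + ∑ ys g
  ∑-++ xs ys g = trans (cong sum (map-++ g xs ys)) (sum-++ (List.map g xs) _)

  ∑-const : ∀ (xs : List A) c → ∑ xs (λ _ → c) ≡ length xs * c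
  ∑-const []       c = refl
  ∑-const (x ∷ xs) c = cong (c +_) (∑-const xs c)

  ∑-+ : ∀ (xs : List A) g h → ∑ xs (λ x → g x + h x) ≡ ∑ xs g + ∑ xs h
  ∑-+ []       g h = refl
  ∑-+ (x ∷ xs) g h = trans (cong (g x + h x +_) (∑-+ xs g h)) (+-interchange (g x) (h x) _ _)

  ∑-*ˡ : ∀ (xs : List A) g c → c * ∑ xs g ≡ ∑ xs (λ x → c * g x)
  ∑-*ˡ []       g c = *-zeroʳ c
  ∑-*ˡ (x ∷ xs) g c = trans (*-distribˡ-+ c (g x) _) (cong (c * g x +_) (∑-*ˡ xs g c))

  ∑-*ʳ : ∀ (xs : List A) g c → ∑ xs g * c ≡ ∑ xs (λ x → g x * c)
  ∑-*ʳ []       g c = refl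
  ∑-*ʳ (x ∷ xs) g c = trans (*-distribʳ-+ c (g x) _) (cong (g x * c +_) (∑-*ʳ xs g c))

  ∑-zero : ∀ (xs : List A) {g} → (∀ x → x ∈ xs → g x ≡ 0) → ∑ xs g ≡ 0
  ∑-zero []       e = refl
  ∑-zero (x ∷ xs) e = cong₂ _+_ (e x (here refl)) (∑-zero xs (λ y y∈ → e y (there y∈)))

  length-∑ : ∀ (xs : List A) → length xs ≡ ∑ xs (λ _ → 1)
  length-∑ xs = sym (trans (∑-const xs 1) (*-identityʳ (length xs)))

  ∑-unique : ∀ {xs ys : List A} g → Unique xs → Unique ys → (∀ {z} → z ∈ xs ⇔ z ∈ ys) →
             ∑ xs g ≡ ∑ ys g
  ∑-unique g ux uy same = sum-↭ (↭.map⁺ g (∼bag⇒↭ (unique∧set⇒bag ux uy same)))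

module _ {A B : Set} where

  ∑-map : ∀ (f : A → B) xs g → ∑ (List.map f xs) g ≡ ∑ xs (g ∘ f)
  ∑-map f xs g = cong sum (sym (map-∘ xs))

  ∑-concatMap : ∀ (f : A → List B) xs g → ∑ (concatMap f xs) g ≡ ∑ xs (λ x → ∑ (f x) g)
  ∑-concatMap f []       g = refl
  ∑-concatMap f (x ∷ xs) g = trans (∑-++ (f x) _ g) (cong (∑ (f x) g +_) (∑-concatMap f xs g))

  ∑-swap : ∀ (xs : List A) (ys : List B) (h : A → B → ℕ) →
           ∑ xs (λ x → ∑ ys (h x)) ≡ ∑ ys (λ y → ∑ xs (λ x → h x y))
  ∑-swap []       ys h = sym (trans (∑-const ys 0) (*-zeroʳ (length ys)))
  ∑-swap (x ∷ xs) ys h = trans (cong (∑ ys (h x) +_) (∑-swap xs ys h)) (sym (∑-+ ys (h x) _))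

  ∑-product : ∀ (xs : List A) (ys : List B) f g →
              ∑ xs f * ∑ ys g ≡ ∑ xs (λ a → ∑ ys (λ b → f a * g b))
  ∑-product xs ys f g = trans (∑-*ʳ xs f (∑ ys g)) (∑-cong xs (λ a _ → ∑-*ˡ ys g (f a)))

  length-concatMap : ∀ (f : A → List B) xs → length (concatMap f xs) ≡ ∑ xs (length ∘ f)
  length-concatMap f xs = trans (length-∑ (concatMap f xs))
    (trans (∑-concatMap f xs _) (∑-cong xs (λ x _ → sym (length-∑ (f x)))))

module _ {A B C : Set} (f : A → B → C) where

  ∑-cartesianProductWith : ∀ xs ys g →
    ∑ (cartesianProductWith f xs ys) g ≡ ∑ xs (λ a → ∑ ys (λ b → g (f a b)))
  ∑-cartesianProductWith []       ys g = refl
  ∑-cartesianProductWith (x ∷ xs) ys g =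
    trans (∑-++ (List.map (f x) ys) _ g)
          (cong₂ _+_ (∑-map (f x) ys g) (∑-cartesianProductWith xs ys g))

  length-cartesianProductWith : ∀ xs ys →
    length (cartesianProductWith f xs ys) ≡ length xs * length ys
  length-cartesianProductWith xs ys = begin
    length (cartesianProductWith f xs ys)      ≡⟨ length-∑ (cartesianProductWith f xs ys) ⟩
    ∑ (cartesianProductWith f xs ys) (λ _ → 1) ≡⟨ ∑-cartesianProductWith xs ys _ ⟩
    ∑ xs (λ _ → ∑ ys (λ _ → 1))                ≡⟨ ∑-const xs _ ⟩
    length xs * ∑ ys (λ _ → 1)                 ≡⟨ cong (length xs *_) (length-∑ ys) ⟨
    length xs * length ys                      ∎
    where open ≡-Reasoning

module _ {A B : Set} (f : A → List B) (key : B → A) where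

  Unique-concatMap : ∀ {xs} → Unique xs → (∀ x → Unique (f x)) →
                     (∀ x {y} → y ∈ f x → key y ≡ x) → Unique (concatMap f xs)
  Unique-concatMap []            uf kf = []
  Unique-concatMap {x ∷ xs} (x∉ ∷ u) uf kf = Unique.++⁺ (uf x) (Unique-concatMap u uf kf) disjoint
    where
    disjoint : ∀ {v} → ¬ (v ∈ f x × v ∈ concatMap f xs)
    disjoint (v∈fx , v∈rest) with find (∈-concatMap⁻ f v∈rest)
    ... | x' , x'∈xs , v∈fx' = All.lookup x∉ x'∈xs (trans (sym (kf x v∈fx)) (kf x' v∈fx'))

module _ {A : Set} {xs : List A} (unique : Unique xs) (complete : ∀ a → a ∈ xs) where

  ∑-reindex : (f g : A → A) → (∀ a → f (g a) ≡ a) → (∀ a → g (f a) ≡ a) →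
              ∀ h → ∑ xs (h ∘ f) ≡ ∑ xs h
  ∑-reindex f g fg gf h = trans (sym (∑-map f xs h))
    (∑-unique h (Unique.map⁺ f-injective unique) unique
      (λ {z} → mk⇔ (λ _ → complete z)
                   (λ _ → ≡-subst (_∈ List.map f xs) (fg z) (∈-map⁺ f (complete (g z))))))
    where
    f-injective : ∀ {a b} → f a ≡ f b → a ≡ b
    f-injective {a} {b} e = trans (sym (gf a)) (trans (cong g e) (gf b))

apply-injective : ∀ {n} (σ : Perm n) → Injective _≡_ _≡_ (apply σ)
apply-injective (k ∷ σ) {zero}  {zero}  e = refl
apply-injective (k ∷ σ) {zero}  {suc j} e = ⊥-elim (punchInᵢ≢i k _ (sym e))
apply-injective (k ∷ σ) {suc i} {zero}  e = ⊥-elim (punchInᵢ≢i k _ e)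
apply-injective (k ∷ σ) {suc i} {suc j} e = cong suc (apply-injective σ (punchIn-injective k _ _ e))

perm-ext : ∀ {n} (σ τ : Perm n) → (∀ i → apply σ i ≡ apply τ i) → σ ≡ τ
perm-ext []      []      e = refl
perm-ext (i ∷ σ) (j ∷ τ) e with e zero
... | refl = cong (i ∷_) (perm-ext σ τ (λ k → punchIn-injective i _ _ (e (suc k))))

apply⁻¹ : ∀ {n} → Perm n → Fin n → Fin n
apply⁻¹ (i ∷ σ) k with i Fin.≟ k
... | yes _  = zero
... | no i≢k = suc (apply⁻¹ σ (punchOut i≢k))

apply-apply⁻¹ : ∀ {n} (σ : Perm n) k → apply σ (apply⁻¹ σ k) ≡ k
apply-apply⁻¹ (i ∷ σ) k with i Fin.≟ k
... | yes i≡k = i≡k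
... | no i≢k  = trans (cong (punchIn i) (apply-apply⁻¹ σ _)) (punchIn-punchOut i≢k)

apply⁻¹-apply : ∀ {n} (σ : Perm n) i → apply⁻¹ σ (apply σ i) ≡ i
apply⁻¹-apply σ i = apply-injective σ (apply-apply⁻¹ σ (apply σ i))

apply⁻¹-injective : ∀ {n} (σ : Perm n) → Injective _≡_ _≡_ (apply⁻¹ σ)
apply⁻¹-injective σ {i} {j} e =
  trans (sym (apply-apply⁻¹ σ i)) (trans (cong (apply σ) e) (apply-apply⁻¹ σ j))

fromInjection : ∀ {n} (f : Fin n → Fin n) → Injective _≡_ _≡_ f → Perm n
fromInjection {zero}  f f-inj = []
fromInjection {suc n} f f-inj = f zero ∷ fromInjection f′ f′-inj
  where
  f0≢f : ∀ j → f zero ≢ f (suc j)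
  f0≢f j e = 0≢1+n (f-inj e)
  f′ : Fin n → Fin n
  f′ j = punchOut (f0≢f j)
  f′-inj : Injective _≡_ _≡_ f′
  f′-inj e = suc-injective (f-inj (punchOut-injective (f0≢f _) (f0≢f _) e))

apply-fromInjection : ∀ {n} (f : Fin n → Fin n) (f-inj : Injective _≡_ _≡_ f) i →
                      apply (fromInjection f f-inj) i ≡ f i
apply-fromInjection f f-inj zero    = refl
apply-fromInjection f f-inj (suc i) =
  trans (cong (punchIn (f zero)) (apply-fromInjection _ _ i)) (punchIn-punchOut _)

infixr 9 _∘ₚ_
infix 10 _⁻¹ₚ

_∘ₚ_ : ∀ {n} → Perm n → Perm n → Perm n
ρ ∘ₚ σ = fromInjection (apply ρ ∘ apply σ) (apply-injective σ ∘ apply-injective ρ)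

apply-∘ₚ : ∀ {n} (ρ σ : Perm n) i → apply (ρ ∘ₚ σ) i ≡ apply ρ (apply σ i)
apply-∘ₚ ρ σ = apply-fromInjection _ _

_⁻¹ₚ : ∀ {n} → Perm n → Perm n
σ ⁻¹ₚ = fromInjection (apply⁻¹ σ) (apply⁻¹-injective σ)

apply-⁻¹ₚ : ∀ {n} (σ : Perm n) i → apply (σ ⁻¹ₚ) i ≡ apply⁻¹ σ i
apply-⁻¹ₚ σ = apply-fromInjection _ _

⁻¹ₚ-inverseʳ : ∀ {n} (σ : Perm n) i → apply σ (apply (σ ⁻¹ₚ) i) ≡ i
⁻¹ₚ-inverseʳ σ i = trans (cong (apply σ) (apply-⁻¹ₚ σ i)) (apply-apply⁻¹ σ i)

⁻¹ₚ-inverseˡ : ∀ {n} (σ : Perm n) i → apply (σ ⁻¹ₚ) (apply σ i) ≡ i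
⁻¹ₚ-inverseˡ σ i = trans (apply-⁻¹ₚ σ (apply σ i)) (apply⁻¹-apply σ i)

apply⁻¹-unique : ∀ {n} (σ : Perm n) {j k} → apply σ j ≡ k → apply⁻¹ σ k ≡ j
apply⁻¹-unique σ {j} e = trans (cong (apply⁻¹ σ) (sym e)) (apply⁻¹-apply σ j)

∘ₚ-cancel : ∀ {n} (ρ ρ' : Perm n) → (∀ i → apply ρ (apply ρ' i) ≡ i) → ∀ σ → ρ ∘ₚ ρ' ∘ₚ σ ≡ σ
∘ₚ-cancel ρ ρ' ρρ' σ = perm-ext (ρ ∘ₚ ρ' ∘ₚ σ) σ (λ i →
  trans (apply-∘ₚ ρ (ρ' ∘ₚ σ) i) (trans (cong (apply ρ) (apply-∘ₚ ρ' σ i)) (ρρ' (apply σ i))))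

allPerms : ∀ n → List (Perm n)
allPerms zero    = [] ∷ []
allPerms (suc n) = concatMap (λ i → List.map (i ∷_) (allPerms n)) (allFin (suc n))

∈-allPerms : ∀ {n} (σ : Perm n) → σ ∈ allPerms n
∈-allPerms []      = here refl
∈-allPerms (i ∷ σ) = ∈-concatMap⁺ (λ j → List.map (j ∷_) (allPerms _))
                                  (lose (∈-allFin i) (∈-map⁺ (i ∷_) (∈-allPerms σ)))

allPerms-unique : ∀ n → Unique (allPerms n)
allPerms-unique zero    = [] ∷ []
allPerms-unique (suc n) =
  Unique-concatMap _ head (Unique.allFin⁺ (suc n))
    (λ i → Unique.map⁺ tail-≡ (allPerms-unique n))
    (λ i y∈ → head-∷ (∈-map⁻ (i ∷_) y∈))
  where
  head : Perm (suc n) → Fin (suc n)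
  head (i ∷ _) = i
  tail-≡ : ∀ {i} {σ τ : Perm n} → i ∷ σ ≡ i ∷ τ → σ ≡ τ
  tail-≡ refl = refl
  head-∷ : ∀ {i y} → (∃ λ σ → σ ∈ allPerms n × y ≡ i ∷ σ) → head y ≡ i
  head-∷ (_ , _ , refl) = refl

∑-perm-reindex : ∀ {n} (f g : Perm n → Perm n) → (∀ σ → f (g σ) ≡ σ) → (∀ σ → g (f σ) ≡ σ) →
                 ∀ h → ∑ (allPerms n) (h ∘ f) ≡ ∑ (allPerms n) h
∑-perm-reindex {n} = ∑-reindex (allPerms-unique n) ∈-allPerms

HasCard-inhabited : ∀ {A : Set} {P : A → Set} {k} → HasCard P k → (∃ P ⇔ 0 < k)
HasCard-inhabited {P = P} (xs , refl , _ , members) =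
  mk⇔ (λ (a , pa) → nonempty (Equivalence.from (members a) pa))
      (λ pos → let a , a∈ = first pos in a , Equivalence.to (members a) a∈)
  where
  nonempty : ∀ {a ys} → a ∈ ys → 0 < length ys
  nonempty (here _)  = s≤s z≤n
  nonempty (there _) = s≤s z≤n
  first : ∀ {ys} → 0 < length ys → ∃ (_∈ ys)
  first {y ∷ _} _ = y , here refl

HasCard-nonzero : ∀ {A : Set} {P : A → Set} {k} → HasCard P k → ∃ P → k ≢ 0
HasCard-nonzero card inhabited k≡0 =
  <⇒≢ (Equivalence.to (HasCard-inhabited card) inhabited) (sym k≡0)

HasCard-cong : ∀ {A : Set} {P Q : A → Set} {k} → (∀ a → P a ⇔ Q a) → HasCard P k → HasCard Q k
HasCard-cong P⇔Q (xs , len , unique , members) =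
  xs , len , unique , λ a → mk⇔ (Equivalence.to (P⇔Q a) ∘ Equivalence.to (members a))
                                (Equivalence.from (members a) ∘ Equivalence.from (P⇔Q a))

∑-support : ∀ {A : Set} (g : A → ℕ) K → (∀ a → 0 < g a → g a ≡ K) →
            ∀ xs → ∑ xs g ≡ length (filter (λ a → 0 <? g a) xs) * K
∑-support g K const []       = refl
∑-support g K const (a ∷ xs) with 0 <? g a
... | yes pos = trans (cong₂ _+_ (const a pos) (∑-support g K const xs))
                      (cong (λ ys → length ys * K) (sym (filter-accept (λ a → 0 <? g a) pos)))
... | no ¬pos = trans (trans (cong (_+ ∑ xs g) (n≤0⇒n≡0 (≮⇒≥ ¬pos))) (∑-support g K const xs))
                      (cong (λ ys → length ys * K) (sym (filter-reject (λ a → 0 <? g a) ¬pos)))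

card-by-weights : ∀ {n} (S : Perm n → Set) (g : Perm n → ℕ) (K : ℕ) →
                  (∀ σ → S σ ⇔ 0 < g σ) → (∀ σ → 0 < g σ → g σ ≡ K) →
                  Σ ℕ λ k → HasCard S k × k * K ≡ ∑ (allPerms n) g
card-by-weights {n} S g K S⇔pos const =
  length support ,
  (support , refl , Unique.filter⁺ (λ σ → 0 <? g σ) (allPerms-unique n) ,
   λ σ → mk⇔ (λ σ∈ → Equivalence.from (S⇔pos σ)
                         (proj₂ (∈-filter⁻ (λ σ → 0 <? g σ) {xs = allPerms n} σ∈)))
             (λ s → ∈-filter⁺ (λ σ → 0 <? g σ) (∈-allPerms σ) (Equivalence.to (S⇔pos σ) s))) ,
  sym (∑-support g K const (allPerms n))
  where
  support = filter (λ σ → 0 <? g σ) (allPerms n)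

module _ {X W : Set} (Iso : W → X → X → Set) (#≃ : X → X → ℕ)
         (card : ∀ u v → HasCard (λ w → Iso w u v) (#≃ u v))
         (respects : ∀ u {w v v'} → Iso w v v' → #≃ u v ≡ #≃ u v') where

  count-isomorphic : ∀ {n} (t : X) (f : Perm n → X) →
                     Σ ℕ λ k → HasCard (λ σ → ∃ λ w → Iso w t (f σ)) k
                             × k * #≃ t t ≡ ∑ (allPerms n) (λ σ → #≃ t (f σ))
  count-isomorphic t f = card-by-weights _ (λ σ → #≃ t (f σ)) (#≃ t t)
    (λ σ → HasCard-inhabited (card t (f σ)))
    (λ σ pos → sym (respects t (proj₂ (Equivalence.from (HasCard-inhabited (card t (f σ))) pos))))

module _ {A : Set} where

  lookup-act : ∀ {n} (σ : Perm n) (v : Vec A n) i → lookup (act σ v) (apply σ i) ≡ lookup v i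
  lookup-act (j ∷ σ) (a ∷ v) zero    = insertAt-lookup (act σ v) j a
  lookup-act (j ∷ σ) (a ∷ v) (suc i) =
    trans (insertAt-punchIn (act σ v) j a (apply σ i)) (lookup-act σ v i)

  lookup-act⁻¹ : ∀ {n} (σ : Perm n) (v : Vec A n) k → lookup (act σ v) k ≡ lookup v (apply⁻¹ σ k)
  lookup-act⁻¹ σ v k =
    trans (cong (lookup (act σ v)) (sym (apply-apply⁻¹ σ k))) (lookup-act σ v (apply⁻¹ σ k))

  lookup-removeAt : ∀ {n} (v : Vec A (suc n)) i j → lookup (removeAt v i) j ≡ lookup v (punchIn i j)
  lookup-removeAt v i j =
    trans (cong (lookup (removeAt v i)) (sym (punchOut-punchIn i))) (removeAt-punchOut v _)

  lookup-take : ∀ m {n} (v : Vec A (m + n)) i → lookup v (i ↑ˡ n) ≡ lookup (take m v) i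
  lookup-take m v i = trans (cong (λ w → lookup w (i ↑ˡ _)) (sym (take++drop≡id m v)))
                            (lookup-++ˡ (take m v) (drop m v) i)

  lookup-drop : ∀ m {n} (v : Vec A (m + n)) i → lookup v (m ↑ʳ i) ≡ lookup (drop m v) i
  lookup-drop m v i = trans (cong (λ w → lookup w (m ↑ʳ i)) (sym (take++drop≡id m v)))
                            (lookup-++ʳ (take m v) (drop m v) i)

  take-++ : ∀ {m n} (u : Vec A m) (w : Vec A n) → take m (u Vec.++ w) ≡ u
  take-++ {m} u w = ++-injectiveˡ (take m (u Vec.++ w)) u (take++drop≡id m (u Vec.++ w))

  drop-++ : ∀ {m n} (u : Vec A m) (w : Vec A n) → drop m (u Vec.++ w) ≡ w
  drop-++ {m} u w = ++-injectiveʳ (take m (u Vec.++ w)) u (take++drop≡id m (u Vec.++ w))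

  toList-take : ∀ m {n} (v : Vec A (m + n)) → List.take m (toList v) ≡ toList (take m v)
  toList-take zero    v       = refl
  toList-take (suc m) (a ∷ v) = cong (a ∷_) (toList-take m v)

  toList-drop : ∀ m {n} (v : Vec A (m + n)) → List.drop m (toList v) ≡ toList (drop m v)
  toList-drop zero    v       = refl
  toList-drop (suc m) (a ∷ v) = toList-drop m v

[_∣_] : ∀ {n₁ n₂ m} → (Fin n₁ → Fin m) → (Fin n₂ → Fin m) → Fin (n₁ + n₂) → Fin m
[_∣_] {n₁} f g i = [ f , g ]′ (Fin.splitAt n₁ i)

module _ {n₁ n₂ m} (f : Fin n₁ → Fin m) (g : Fin n₂ → Fin m) where

  [∣]-↑ˡ : ∀ i → [ f ∣ g ] (i ↑ˡ n₂) ≡ f i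
  [∣]-↑ˡ i = cong [ f , g ]′ (splitAt-↑ˡ n₁ i n₂)

  [∣]-↑ʳ : ∀ i → [ f ∣ g ] (n₁ ↑ʳ i) ≡ g i
  [∣]-↑ʳ i = cong [ f , g ]′ (splitAt-↑ʳ n₁ n₂ i)

  [∣]-injective : Injective _≡_ _≡_ f → Injective _≡_ _≡_ g → (∀ i j → f i ≢ g j) →
                  Injective _≡_ _≡_ [ f ∣ g ]
  [∣]-injective f-inj g-inj apart {i} {j} e
    with Fin.splitAt n₁ i in eqi | Fin.splitAt n₁ j in eqj
  ... | inj₁ a | inj₁ b =
    trans (sym (splitAt⁻¹-↑ˡ eqi)) (trans (cong (_↑ˡ n₂) (f-inj e)) (splitAt⁻¹-↑ˡ eqj))
  ... | inj₁ a | inj₂ b = ⊥-elim (apart a b e)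
  ... | inj₂ a | inj₁ b = ⊥-elim (apart b a (sym e))
  ... | inj₂ a | inj₂ b =
    trans (sym (splitAt⁻¹-↑ʳ eqi)) (trans (cong (n₁ ↑ʳ_) (g-inj e)) (splitAt⁻¹-↑ʳ eqj))

↑ˡ≢↑ʳ : ∀ {n₁ n₂} (i : Fin n₁) (j : Fin n₂) → i ↑ˡ n₂ ≢ n₁ ↑ʳ j
↑ˡ≢↑ʳ {n₁} {n₂} i j e
  with trans (sym (splitAt-↑ˡ n₁ i n₂)) (trans (cong (Fin.splitAt n₁) e) (splitAt-↑ʳ n₁ n₂ j))
... | ()

∏ : ∀ {n} → (Fin n → ℕ) → ℕ
∏ {zero}  f = 1
∏ {suc n} f = f zero * ∏ (f ∘ suc)

∏-cong : ∀ {n} {f g : Fin n → ℕ} → (∀ i → f i ≡ g i) → ∏ f ≡ ∏ g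
∏-cong {zero}  e = refl
∏-cong {suc n} e = cong₂ _*_ (e zero) (∏-cong (e ∘ suc))

∏-split : ∀ n₁ {n₂} (f : Fin (n₁ + n₂) → ℕ) → ∏ f ≡ ∏ (λ i → f (i ↑ˡ n₂)) * ∏ (λ i → f (n₁ ↑ʳ i))
∏-split zero    f = sym (*-identityˡ _)
∏-split (suc n₁) f = trans (cong (f zero *_) (∏-split n₁ (f ∘ suc))) (sym (*-assoc (f zero) _ _))

∏-[∣] : ∀ {n₁ n₂ m} (F : Fin (n₁ + n₂) → Fin m → ℕ) (f : Fin n₁ → Fin m) (g : Fin n₂ → Fin m) →
        ∏ (λ i → F i ([ f ∣ g ] i)) ≡ ∏ (λ i → F (i ↑ˡ n₂) (f i)) * ∏ (λ i → F (n₁ ↑ʳ i) (g i))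
∏-[∣] {n₁} {n₂} F f g = trans (∏-split n₁ _)
  (cong₂ _*_ (∏-cong (λ i → cong (F (i ↑ˡ n₂)) ([∣]-↑ˡ f g i)))
             (∏-cong (λ i → cong (F (n₁ ↑ʳ i)) ([∣]-↑ʳ f g i))))

TupIsos : ∀ {n} → Vec Term n → Vec Term n → Perm n × Vec PExpr n → Set
TupIsos ds es (σ , αs) = TupIso σ αs ds es

-- A tuple isomorphism (σ, α⃗) : (d ∷ ds) ≅ es sends d to some es_j via α₁ and
-- ds to the remaining entries; so #isos sums over the partner j of d.
mutual
  #iso : Term → Term → ℕ
  #iso (var y)    (var y') with y ≟ y'
  ... | yes _ = 1
  ... | no _  = 0
  #iso (lam a)    (lam a')     = #iso a a'
  #iso (app c ds) (app c' ds') = #iso c c' * #isos ds ds'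
  #iso (inl a)    (inl a')     = #iso a a'
  #iso (inr a)    (inr a')     = #iso a a'
  #iso _          _            = 0

  #isos : ∀ {n m} → Vec Term n → Vec Term m → ℕ
  #isos []       []       = 1
  #isos []       (_ ∷ _)  = 0
  #isos (_ ∷ _)  []       = 0
  #isos (d ∷ ds) (e ∷ es) =
    ∑ (allFin _) (λ j → #iso d (lookup (e ∷ es) j) * #isos ds (removeAt (e ∷ es) j))

#isos-≢ : ∀ {n m} (ds : Vec Term n) (es : Vec Term m) → n ≢ m → #isos ds es ≡ 0
#isos-≢ []       []       n≢m = ⊥-elim (n≢m refl)
#isos-≢ []       (_ ∷ _)  n≢m = refl
#isos-≢ (_ ∷ _)  []       n≢m = refl
#isos-≢ (d ∷ ds) (e ∷ es) n≢m = ∑-zero (allFin _) (λ j _ →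
  trans (cong (#iso d (lookup (e ∷ es) j) *_) (#isos-≢ ds (removeAt (e ∷ es) j) (n≢m ∘ cong suc)))
        (*-zeroʳ (#iso d (lookup (e ∷ es) j))))

#isosAlong : ∀ {n m} → Vec Term n → Vec Term m → (Fin n → Fin m) → ℕ
#isosAlong ds es f = ∏ (λ i → #iso (lookup ds i) (lookup es (f i)))

#isosAlong-cong : ∀ {n m m'} (b : Vec Term n) {c : Vec Term m} {c' : Vec Term m'}
                  {f : Fin n → Fin m} {g : Fin n → Fin m'} →
                  (∀ i → lookup c (f i) ≡ lookup c' (g i)) → #isosAlong b c f ≡ #isosAlong b c' g
#isosAlong-cong b same = ∏-cong (λ i → cong (#iso (lookup b i)) (same i))

#isos-perms : ∀ {n} (ds es : Vec Term n) →
              #isos ds es ≡ ∑ (allPerms n) (#isosAlong ds es ∘ apply)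
#isos-perms []               []       = refl
#isos-perms {suc n} (d ∷ ds) (e ∷ es) = sym (begin
  ∑ (allPerms (suc n)) (#isosAlong (d ∷ ds) E ∘ apply)
    ≡⟨ ∑-concatMap (λ j → List.map (j ∷_) (allPerms n)) (allFin (suc n)) _ ⟩
  ∑ (allFin (suc n)) (λ j → ∑ (List.map (j ∷_) (allPerms n)) (#isosAlong (d ∷ ds) E ∘ apply))
    ≡⟨ ∑-cong (allFin (suc n)) (λ j _ → ∑-map (j ∷_) (allPerms n) _) ⟩
  ∑ (allFin (suc n)) (λ j → ∑ (allPerms n) (λ π → #iso d (lookup E j) * rest j π))
    ≡⟨ ∑-cong (allFin (suc n)) (λ j _ → sym (∑-*ˡ (allPerms n) (rest j) (#iso d (lookup E j)))) ⟩
  ∑ (allFin (suc n)) (λ j → #iso d (lookup E j) * ∑ (allPerms n) (rest j))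
    ≡⟨ ∑-cong (allFin (suc n)) (λ j _ → cong (#iso d (lookup E j) *_) (sym (#isos-perms-rest j))) ⟩
  ∑ (allFin (suc n)) (λ j → #iso d (lookup E j) * #isos ds (removeAt E j))
    ∎)
  where
  open ≡-Reasoning
  E = e ∷ es
  rest : Fin (suc n) → Perm n → ℕ
  rest j π = ∏ (λ i → #iso (lookup ds i) (lookup E (punchIn j (apply π i))))
  #isos-perms-rest : ∀ j → #isos ds (removeAt E j) ≡ ∑ (allPerms n) (rest j)
  #isos-perms-rest j = trans (#isos-perms ds (removeAt E j))
    (∑-cong (allPerms n) (λ π _ → ∏-cong (λ i →
      cong (#iso (lookup ds i)) (lookup-removeAt E j (apply π i)))))

#isos-permute : ∀ {n k} (ds : Vec Term n) {fs fs' : Vec Term k} (τ : Perm k) →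
                (∀ a i → #iso a (lookup fs i) ≡ #iso a (lookup fs' (apply τ i))) →
                #isos ds fs ≡ #isos ds fs'
#isos-permute {n} {k} ds {fs} {fs'} τ same with n ≟ k
... | no n≢k = trans (#isos-≢ ds fs n≢k) (sym (#isos-≢ ds fs' n≢k))
... | yes refl = begin
  #isos ds fs                                     ≡⟨ #isos-perms ds fs ⟩
  ∑ (allPerms n) (#isosAlong ds fs ∘ apply)       ≡⟨ ∑-cong (allPerms n) (λ σ _ → ∏-cong (step σ)) ⟩
  ∑ (allPerms n) (#isosAlong ds fs' ∘ apply ∘ (τ ∘ₚ_))
    ≡⟨ ∑-perm-reindex (τ ∘ₚ_) (τ ⁻¹ₚ ∘ₚ_) (∘ₚ-cancel τ (τ ⁻¹ₚ) (⁻¹ₚ-inverseʳ τ))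
                                          (∘ₚ-cancel (τ ⁻¹ₚ) τ (⁻¹ₚ-inverseˡ τ)) _ ⟩
  ∑ (allPerms n) (#isosAlong ds fs' ∘ apply)      ≡⟨ #isos-perms ds fs' ⟨
  #isos ds fs'                                    ∎
  where
  open ≡-Reasoning
  step : ∀ σ i → #iso (lookup ds i) (lookup fs (apply σ i))
               ≡ #iso (lookup ds i) (lookup fs' (apply (τ ∘ₚ σ) i))
  step σ i = trans (same (lookup ds i) (apply σ i))
                   (cong (#iso (lookup ds i) ∘ lookup fs') (sym (apply-∘ₚ τ σ i)))

#iso-respects-≅ : ∀ a {ε b b'} → ε ∶ b ≅ b' → #iso a b ≡ #iso a b'
#iso-respects-≅ a          pid        = refl
#iso-respects-≅ (lam a)    (plam d)   = #iso-respects-≅ a d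
#iso-respects-≅ (app c ds) (papp {σ = σ} d ds≅) =
  cong₂ _*_ (#iso-respects-≅ c d) (#isos-permute ds σ (λ a i → #iso-respects-≅ a (ds≅ i)))
#iso-respects-≅ (inl a)    (pinl d)   = #iso-respects-≅ a d
#iso-respects-≅ (inr a)    (pinr d)   = #iso-respects-≅ a d
#iso-respects-≅ (var _)    (plam _)   = refl
#iso-respects-≅ (app _ _)  (plam _)   = refl
#iso-respects-≅ (inl _)    (plam _)   = refl
#iso-respects-≅ (inr _)    (plam _)   = refl
#iso-respects-≅ (var _)    (papp _ _) = refl
#iso-respects-≅ (lam _)    (papp _ _) = refl
#iso-respects-≅ (inl _)    (papp _ _) = refl
#iso-respects-≅ (inr _)    (papp _ _) = refl
#iso-respects-≅ (var _)    (pinl _)   = refl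
#iso-respects-≅ (lam _)    (pinl _)   = refl
#iso-respects-≅ (app _ _)  (pinl _)   = refl
#iso-respects-≅ (inr _)    (pinl _)   = refl
#iso-respects-≅ (var _)    (pinr _)   = refl
#iso-respects-≅ (lam _)    (pinr _)   = refl
#iso-respects-≅ (app _ _)  (pinr _)   = refl
#iso-respects-≅ (inl _)    (pinr _)   = refl

#isos-respects-≅ : ∀ {n k} (us : Vec Term n) {w} {vs vs' : Vec Term k} → TupIsos vs vs' w →
                   #isos us vs ≡ #isos us vs'
#isos-respects-≅ us {σ , αs} iso = #isos-permute us σ (λ a i → #iso-respects-≅ a (iso i))

appIso : (n : ℕ) → PExpr → Perm n × Vec PExpr n → PExpr
appIso n γ (σ , αs) = papp γ n σ αs

consIso : ∀ {n} → Fin (suc n) → PExpr → Perm n × Vec PExpr n → Perm (suc n) × Vec PExpr (suc n)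
consIso j ε (π , αs) = j ∷ π , ε ∷ αs

mutual
  isos : Term → Term → List PExpr
  isos (var y) (var y') with y ≟ y'
  ... | yes _ = pid y ∷ []
  ... | no _  = []
  isos (lam a) (lam a') = List.map plam (isos a a')
  isos (app c {n} ds) (app c' {m} ds') with n ≟ m
  ... | yes refl = cartesianProductWith (appIso n) (isos c c') (tupleIsos ds ds')
  ... | no _     = []
  isos (inl a) (inl a') = List.map pinl (isos a a')
  isos (inr a) (inr a') = List.map pinr (isos a a')
  isos _       _        = []

  tupleIsos : ∀ {n} → Vec Term n → Vec Term n → List (Perm n × Vec PExpr n)
  tupleIsos []       []  = ([] , []) ∷ []
  tupleIsos (d ∷ ds) es  = concatMap (tupleIsosVia d ds es) (allFin _)

  tupleIsosVia : ∀ {n} → Term → Vec Term n → Vec Term (suc n) → Fin (suc n) →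
                 List (Perm (suc n) × Vec PExpr (suc n))
  tupleIsosVia d ds es j =
    cartesianProductWith (consIso j) (isos d (lookup es j)) (tupleIsos ds (removeAt es j))

mutual
  length-isos : ∀ a a' → length (isos a a') ≡ #iso a a'
  length-isos (var y) (var y') with y ≟ y'
  ... | yes _ = refl
  ... | no _  = refl
  length-isos (lam a) (lam a') = trans (length-map plam (isos a a')) (length-isos a a')
  length-isos (app c {n} ds) (app c' {m} ds') with n ≟ m
  ... | yes refl = trans (length-cartesianProductWith (appIso n) (isos c c') (tupleIsos ds ds'))
                         (cong₂ _*_ (length-isos c c') (length-tupleIsos ds ds'))
  ... | no n≢m   = sym (trans (cong (#iso c c' *_) (#isos-≢ ds ds' n≢m)) (*-zeroʳ (#iso c c')))
  length-isos (inl a) (inl a') = trans (length-map pinl (isos a a')) (length-isos a a')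
  length-isos (inr a) (inr a') = trans (length-map pinr (isos a a')) (length-isos a a')
  length-isos (var _)   (lam _)   = refl
  length-isos (var _)   (app _ _) = refl
  length-isos (var _)   (inl _)   = refl
  length-isos (var _)   (inr _)   = refl
  length-isos (lam _)   (var _)   = refl
  length-isos (lam _)   (app _ _) = refl
  length-isos (lam _)   (inl _)   = refl
  length-isos (lam _)   (inr _)   = refl
  length-isos (app _ _) (var _)   = refl
  length-isos (app _ _) (lam _)   = refl
  length-isos (app _ _) (inl _)   = refl
  length-isos (app _ _) (inr _)   = refl
  length-isos (inl _)   (var _)   = refl
  length-isos (inl _)   (lam _)   = refl
  length-isos (inl _)   (app _ _) = refl
  length-isos (inl _)   (inr _)   = refl
  length-isos (inr _)   (var _)   = refl
  length-isos (inr _)   (lam _)   = refl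
  length-isos (inr _)   (app _ _) = refl
  length-isos (inr _)   (inl _)   = refl

  length-tupleIsos : ∀ {n} (ds es : Vec Term n) → length (tupleIsos ds es) ≡ #isos ds es
  length-tupleIsos []       []       = refl
  length-tupleIsos (d ∷ ds) (e ∷ es) =
    trans (length-concatMap (tupleIsosVia d ds (e ∷ es)) (allFin _))
          (∑-cong (allFin _) (λ j _ →
            trans (length-cartesianProductWith (consIso j) (isos d (lookup (e ∷ es) j)) _)
                  (cong₂ _*_ (length-isos d _) (length-tupleIsos ds (removeAt (e ∷ es) j)))))

TupIso-tail : ∀ {n} {j π ε} {αs : Vec PExpr n} {d ds} (es : Vec Term (suc n)) →
              TupIso (j ∷ π) (ε ∷ αs) (d ∷ ds) es → TupIso π αs ds (removeAt es j)
TupIso-tail {j = j} {π} {αs = αs} {ds = ds} es iso i =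
  ≡-subst (lookup αs i ∶ lookup ds i ≅_) (sym (lookup-removeAt es j (apply π i))) (iso (suc i))

TupIso-cons : ∀ {n} {j π ε} {αs : Vec PExpr n} {d ds} (es : Vec Term (suc n)) →
              ε ∶ d ≅ lookup es j → TupIso π αs ds (removeAt es j) →
              TupIso (j ∷ π) (ε ∷ αs) (d ∷ ds) es
TupIso-cons es d≅ ds≅ zero    = d≅
TupIso-cons {j = j} {π} {αs = αs} {ds = ds} es d≅ ds≅ (suc i) =
  ≡-subst (lookup αs i ∶ lookup ds i ≅_) (lookup-removeAt es j (apply π i)) (ds≅ i)

mutual
  isos-sound : ∀ a a' {ε} → ε ∈ isos a a' → ε ∶ a ≅ a'
  isos-sound (var y) (var y') ε∈ with y ≟ y'
  isos-sound (var y) (var y') (here refl) | yes refl = pid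
  isos-sound (lam a) (lam a') ε∈ with ∈-map⁻ plam ε∈
  ... | α , α∈ , refl = plam (isos-sound a a' α∈)
  isos-sound (app c {n} ds) (app c' {m} ds') ε∈ with n ≟ m
  ... | yes refl with ∈-cartesianProductWith⁻ (appIso n) (isos c c') (tupleIsos ds ds') ε∈
  ... | γ , (σ , αs) , γ∈ , p∈ , refl = papp (isos-sound c c' γ∈) (tupleIsos-sound ds ds' p∈)
  isos-sound (inl a) (inl a') ε∈ with ∈-map⁻ pinl ε∈
  ... | α , α∈ , refl = pinl (isos-sound a a' α∈)
  isos-sound (inr a) (inr a') ε∈ with ∈-map⁻ pinr ε∈
  ... | α , α∈ , refl = pinr (isos-sound a a' α∈)

  tupleIsos-sound : ∀ {n} (ds es : Vec Term n) {σ αs} →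
                    (σ , αs) ∈ tupleIsos ds es → TupIso σ αs ds es
  tupleIsos-sound []       []    (here refl) ()
  tupleIsos-sound (d ∷ ds) es p∈ with find (∈-concatMap⁻ (tupleIsosVia d ds es) {xs = allFin _} p∈)
  ... | j , _ , q∈ with ∈-cartesianProductWith⁻ (consIso j) (isos d (lookup es j)) _ q∈
  ... | ε , (π , αs) , ε∈ , r∈ , refl =
    TupIso-cons es (isos-sound d (lookup es j) ε∈) (tupleIsos-sound ds (removeAt es j) r∈)

mutual
  isos-complete : ∀ a a' {ε} → ε ∶ a ≅ a' → ε ∈ isos a a'
  isos-complete (var y) (var .y) pid with y ≟ y
  ... | yes _  = here refl
  ... | no y≢y = ⊥-elim (y≢y refl)
  isos-complete (lam a) (lam a') (plam d) = ∈-map⁺ plam (isos-complete a a' d)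
  isos-complete (app c {n} ds) (app c' ds') (papp d ds≅) with n ≟ n
  ... | yes refl =
    ∈-cartesianProductWith⁺ (appIso n) (isos-complete c c' d) (tupleIsos-complete ds ds' ds≅)
  ... | no n≢n   = ⊥-elim (n≢n refl)
  isos-complete (inl a) (inl a') (pinl d) = ∈-map⁺ pinl (isos-complete a a' d)
  isos-complete (inr a) (inr a') (pinr d) = ∈-map⁺ pinr (isos-complete a a' d)

  tupleIsos-complete : ∀ {n} (ds es : Vec Term n) {σ αs} →
                       TupIso σ αs ds es → (σ , αs) ∈ tupleIsos ds es
  tupleIsos-complete []       []    {[]}    {[]}    iso = here refl
  tupleIsos-complete (d ∷ ds) es    {j ∷ π} {ε ∷ αs} iso =
    ∈-concatMap⁺ (tupleIsosVia d ds es) (lose (∈-allFin j)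
      (∈-cartesianProductWith⁺ (consIso j) (isos-complete d (lookup es j) (iso zero))
                                           (tupleIsos-complete ds (removeAt es j) (TupIso-tail es iso))))

mutual
  isos-unique : ∀ a a' → Unique (isos a a')
  isos-unique (var y) (var y') with y ≟ y'
  ... | yes _ = [] ∷ []
  ... | no _  = []
  isos-unique (lam a) (lam a') = Unique.map⁺ (λ { refl → refl }) (isos-unique a a')
  isos-unique (app c {n} ds) (app c' {m} ds') with n ≟ m
  ... | yes refl = Unique.cartesianProductWith⁺ (appIso n) appIso-injective
                     (isos-unique c c') (tupleIsos-unique ds ds')
    where
    appIso-injective : ∀ {γ γ' p p'} → appIso n γ p ≡ appIso n γ' p' → γ ≡ γ' × p ≡ p'
    appIso-injective {p = _ , _} {p' = _ , _} refl = refl , refl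
  ... | no _     = []
  isos-unique (inl a) (inl a') = Unique.map⁺ (λ { refl → refl }) (isos-unique a a')
  isos-unique (inr a) (inr a') = Unique.map⁺ (λ { refl → refl }) (isos-unique a a')
  isos-unique (var _)   (lam _)   = []
  isos-unique (var _)   (app _ _) = []
  isos-unique (var _)   (inl _)   = []
  isos-unique (var _)   (inr _)   = []
  isos-unique (lam _)   (var _)   = []
  isos-unique (lam _)   (app _ _) = []
  isos-unique (lam _)   (inl _)   = []
  isos-unique (lam _)   (inr _)   = []
  isos-unique (app _ _) (var _)   = []
  isos-unique (app _ _) (lam _)   = []
  isos-unique (app _ _) (inl _)   = []
  isos-unique (app _ _) (inr _)   = []
  isos-unique (inl _)   (var _)   = []
  isos-unique (inl _)   (lam _)   = []
  isos-unique (inl _)   (app _ _) = []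
  isos-unique (inl _)   (inr _)   = []
  isos-unique (inr _)   (var _)   = []
  isos-unique (inr _)   (lam _)   = []
  isos-unique (inr _)   (app _ _) = []
  isos-unique (inr _)   (inl _)   = []

  -- blocks for different partners j are told apart by σ(0) = j
  tupleIsos-unique : ∀ {n} (ds es : Vec Term n) → Unique (tupleIsos ds es)
  tupleIsos-unique []             []  = [] ∷ []
  tupleIsos-unique {suc n} (d ∷ ds) es =
    Unique-concatMap (tupleIsosVia d ds es) (partner ∘ proj₁) (Unique.allFin⁺ (suc n))
      (λ j → Unique.cartesianProductWith⁺ (consIso j) consIso-injective
               (isos-unique d (lookup es j)) (tupleIsos-unique ds (removeAt es j)))
      (λ j y∈ → partner-via j (∈-cartesianProductWith⁻ (consIso j) (isos d (lookup es j)) _ y∈))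
    where
    partner : Perm (suc n) → Fin (suc n)
    partner (j ∷ _) = j
    consIso-injective : ∀ {j ε ε' p p'} → consIso j ε p ≡ consIso j ε' p' → ε ≡ ε' × p ≡ p'
    consIso-injective {p = _ , _} {p' = _ , _} refl = refl , refl
    partner-via : ∀ j {y} → (∃ λ ε → ∃ λ p → _ × _ × y ≡ consIso j ε p) → partner (proj₁ y) ≡ j
    partner-via j (_ , (_ , _) , _ , _ , refl) = refl

isos-card : ∀ a a' → HasCard (_∶ a ≅ a') (#iso a a')
isos-card a a' = isos a a' , length-isos a a' , isos-unique a a' ,
                 λ ε → mk⇔ (isos-sound a a') (isos-complete a a')

tupleIsos-card : ∀ {n} (ds es : Vec Term n) → HasCard (TupIsos ds es) (#isos ds es)
tupleIsos-card ds es = tupleIsos ds es , length-tupleIsos ds es , tupleIsos-unique ds es ,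
                       λ { (σ , αs) → mk⇔ (tupleIsos-sound ds es) (tupleIsos-complete ds es) }

mutual
  ≅-refl : ∀ a → ∃ (_∶ a ≅ a)
  ≅-refl (var y)        = pid y , pid
  ≅-refl (lam a)        = let α , a≅ = ≅-refl a in plam α , plam a≅
  ≅-refl (app c {n} ds) = let γ , c≅ = ≅-refl c ; p , ds≅ = ≅ᵗ-refl ds
                          in appIso n γ p , papp c≅ ds≅
  ≅-refl (inl a)        = let α , a≅ = ≅-refl a in pinl α , pinl a≅
  ≅-refl (inr a)        = let α , a≅ = ≅-refl a in pinr α , pinr a≅

  ≅ᵗ-refl : ∀ {n} (ds : Vec Term n) → ∃ (TupIsos ds ds)
  ≅ᵗ-refl []       = ([] , []) , λ ()
  ≅ᵗ-refl (d ∷ ds) = let α , d≅ = ≅-refl d ; (π , αs) , ds≅ = ≅ᵗ-refl ds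
                     in (zero ∷ π , α ∷ αs) , λ { zero → d≅ ; (suc i) → ds≅ i }

-- Rigid substitution with a vector of exactly n_x(s) terms: the total
-- function subst of Defs agrees with it (vsubst-agrees), but vsubst
-- splits its argument by take/drop on vectors, which is what counting needs.
mutual
  vsubst : ∀ x (s : Term) → Vec Term (nx x s) → Term
  vsubst x (var y) b with y ≡ᵇ x
  ... | true  = lookup b zero
  ... | false = var y
  vsubst x (lam a)    b = lam (vsubst (suc x) a (Vec.map (shift 0) b))
  vsubst x (app c ds) b = app (vsubst x c (take (nx x c) b)) (vsubsts x ds (drop (nx x c) b))
  vsubst x (inl a)    b = inl (vsubst x a b)
  vsubst x (inr a)    b = inr (vsubst x a b)

  vsubsts : ∀ x {n} (ds : Vec Term n) → Vec Term (nxV x ds) → Vec Term n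
  vsubsts x []       b = []
  vsubsts x (d ∷ ds) b = vsubst x d (take (nx x d) b) ∷ vsubsts x ds (drop (nx x d) b)

mutual
  vsubst-agrees : ∀ x (s : Term) (b : Vec Term (nx x s)) → subst s x (toList b) ≡ vsubst x s b
  vsubst-agrees x (var y) b with y ≡ᵇ x
  vsubst-agrees x (var y) (b ∷ []) | true = refl
  ... | false = refl
  vsubst-agrees x (lam a) b = cong lam (trans (cong (subst a (suc x)) (sym (toList-map (shift 0) b)))
                                              (vsubst-agrees (suc x) a (Vec.map (shift 0) b)))
  vsubst-agrees x (app c ds) b = cong₂ (λ c' ds' → app c' ds')
    (trans (cong (subst c x) (toList-take (nx x c) b)) (vsubst-agrees x c (take (nx x c) b)))
    (trans (cong (substV ds x) (toList-drop (nx x c) b)) (vsubsts-agrees x ds (drop (nx x c) b)))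
  vsubst-agrees x (inl a) b = cong inl (vsubst-agrees x a b)
  vsubst-agrees x (inr a) b = cong inr (vsubst-agrees x a b)

  vsubsts-agrees : ∀ x {n} (ds : Vec Term n) (b : Vec Term (nxV x ds)) →
                   substV ds x (toList b) ≡ vsubsts x ds b
  vsubsts-agrees x []       b = refl
  vsubsts-agrees x (d ∷ ds) b = cong₂ _∷_
    (trans (cong (subst d x) (toList-take (nx x d) b)) (vsubst-agrees x d (take (nx x d) b)))
    (trans (cong (substV ds x) (toList-drop (nx x d) b)) (vsubsts-agrees x ds (drop (nx x d) b)))

-- Going under a binder shifts the substituted terms; shifting is a
-- renaming of free variables, so it preserves isomorphism counts.
shiftIndex : ℕ → ℕ → ℕ
shiftIndex k y = if y <ᵇ k then y else suc y

shift-var : ∀ k y → shift k (var y) ≡ var (shiftIndex k y)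
shift-var k y with y <ᵇ k
... | true  = refl
... | false = refl

<ᵇ-true : ∀ {m n} → (m <ᵇ n) ≡ true → m < n
<ᵇ-true {m} {n} e = <ᵇ⇒< m n (≡-subst T (sym e) tt)

<ᵇ-false : ∀ {m n} → (m <ᵇ n) ≡ false → n ≤ m
<ᵇ-false {m} {n} e = ≮⇒≥ (λ m<n → ≡-subst T e (<⇒<ᵇ m<n))

≤-suc : ∀ {m k} → (m <ᵇ k) ≡ false → k ≤ suc m
≤-suc {m} {k} not-below = ≤-trans (<ᵇ-false {m} {k} not-below) (n≤1+n m)

shiftIndex-injective : ∀ k → Injective _≡_ _≡_ (shiftIndex k)
shiftIndex-injective k {y} {y'} e with y <ᵇ k in below | y' <ᵇ k in below'
... | true  | true  = e
... | false | false = ℕ.suc-injective e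
... | true  | false = ⊥-elim (<⇒≱ (<ᵇ-true {y} {k} below) (≡-subst (k ≤_) (sym e) (≤-suc {y'} below')))
... | false | true  = ⊥-elim (<⇒≱ (<ᵇ-true {y'} {k} below') (≡-subst (k ≤_) e (≤-suc {y} below)))

#iso-var-rename : ∀ (f : ℕ → ℕ) → Injective _≡_ _≡_ f →
                  ∀ y y' → #iso (var (f y)) (var (f y')) ≡ #iso (var y) (var y')
#iso-var-rename f f-inj y y' with f y ≟ f y' | y ≟ y'
... | yes _   | yes _   = refl
... | no _    | no _    = refl
... | yes fy≡ | no y≢   = ⊥-elim (y≢ (f-inj fy≡))
... | no fy≢  | yes y≡  = ⊥-elim (fy≢ (cong f y≡))

lookup-shiftV : ∀ k {n} (es : Vec Term n) j → lookup (shiftV k es) j ≡ shift k (lookup es j)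
lookup-shiftV k (e ∷ es) zero    = refl
lookup-shiftV k (e ∷ es) (suc j) = lookup-shiftV k es j

removeAt-shiftV : ∀ k {n} (es : Vec Term (suc n)) j →
                  removeAt (shiftV k es) j ≡ shiftV k (removeAt es j)
removeAt-shiftV k (e ∷ es)     zero    = refl
removeAt-shiftV k (e ∷ e' ∷ es) (suc j) = cong (shift k e ∷_) (removeAt-shiftV k (e' ∷ es) j)

-- shifting both sides preserves #iso (rewriting shifted variables to variables
-- lets the clauses with different head constructors compute)
mutual
  #iso-shift : ∀ k u v → #iso (shift k u) (shift k v) ≡ #iso u v
  #iso-shift k (var y) (var y') rewrite shift-var k y | shift-var k y' =
    #iso-var-rename (shiftIndex k) (shiftIndex-injective k) y y'
  #iso-shift k (lam a)    (lam a')     = #iso-shift (suc k) a a'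
  #iso-shift k (app c ds) (app c' ds') = cong₂ _*_ (#iso-shift k c c') (#isos-shift k ds ds')
  #iso-shift k (inl a)    (inl a')     = #iso-shift k a a'
  #iso-shift k (inr a)    (inr a')     = #iso-shift k a a'
  #iso-shift k (var y)    (lam _)   rewrite shift-var k y = refl
  #iso-shift k (var y)    (app _ _) rewrite shift-var k y = refl
  #iso-shift k (var y)    (inl _)   rewrite shift-var k y = refl
  #iso-shift k (var y)    (inr _)   rewrite shift-var k y = refl
  #iso-shift k (lam _)    (var y)   rewrite shift-var k y = refl
  #iso-shift k (app _ _)  (var y)   rewrite shift-var k y = refl
  #iso-shift k (inl _)    (var y)   rewrite shift-var k y = refl
  #iso-shift k (inr _)    (var y)   rewrite shift-var k y = refl
  #iso-shift k (lam _)    (app _ _) = refl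
  #iso-shift k (lam _)    (inl _)   = refl
  #iso-shift k (lam _)    (inr _)   = refl
  #iso-shift k (app _ _)  (lam _)   = refl
  #iso-shift k (app _ _)  (inl _)   = refl
  #iso-shift k (app _ _)  (inr _)   = refl
  #iso-shift k (inl _)    (lam _)   = refl
  #iso-shift k (inl _)    (app _ _) = refl
  #iso-shift k (inl _)    (inr _)   = refl
  #iso-shift k (inr _)    (lam _)   = refl
  #iso-shift k (inr _)    (app _ _) = refl
  #iso-shift k (inr _)    (inl _)   = refl

  #isos-shift : ∀ k {n m} (ds : Vec Term n) (es : Vec Term m) →
                #isos (shiftV k ds) (shiftV k es) ≡ #isos ds es
  #isos-shift k []       []       = refl
  #isos-shift k []       (_ ∷ _)  = refl
  #isos-shift k (_ ∷ _)  []       = refl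
  #isos-shift k (d ∷ ds) (e ∷ es) = ∑-cong (allFin _) (λ j _ → cong₂ _*_
    (trans (cong (#iso (shift k d)) (lookup-shiftV k (e ∷ es) j))
           (#iso-shift k d (lookup (e ∷ es) j)))
    (trans (cong (#isos (shiftV k ds)) (removeAt-shiftV k (e ∷ es) j))
           (#isos-shift k ds (removeAt (e ∷ es) j))))

-- The occurrences of x in a tuple es are laid out entry by entry.  For a
-- chosen entry j, blockEmb and restEmb embed the occurrences of x in es_j and
-- in removeAt es j into those of es (injectively, with disjoint images), and
-- block / rest cut a vector indexed by the occurrences of x in es accordingly.
module _ (x : ℕ) where

  blockEmb : ∀ {m} (es : Vec Term m) (j : Fin m) → Fin (nx x (lookup es j)) → Fin (nxV x es)
  blockEmb (e ∷ es) zero    k = k ↑ˡ nxV x es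
  blockEmb (e ∷ es) (suc j) k = nx x e ↑ʳ blockEmb es j k

  restEmb : ∀ {m} (es : Vec Term (suc m)) (j : Fin (suc m)) →
            Fin (nxV x (removeAt es j)) → Fin (nxV x es)
  restEmb (e ∷ es)      zero    = nx x e ↑ʳ_
  restEmb (e ∷ e' ∷ es) (suc j) = [ _↑ˡ nxV x (e' ∷ es) ∣ (nx x e ↑ʳ_) ∘ restEmb (e' ∷ es) j ]

  block : ∀ {m} (es : Vec Term m) (j : Fin m) →
          Vec Term (nxV x es) → Vec Term (nx x (lookup es j))
  block (e ∷ es) zero    c = take (nx x e) c
  block (e ∷ es) (suc j) c = block es j (drop (nx x e) c)

  rest : ∀ {m} (es : Vec Term (suc m)) (j : Fin (suc m)) →
         Vec Term (nxV x es) → Vec Term (nxV x (removeAt es j))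
  rest (e ∷ es)      zero    c = drop (nx x e) c
  rest (e ∷ e' ∷ es) (suc j) c = take (nx x e) c Vec.++ rest (e' ∷ es) j (drop (nx x e) c)

  lookup-block : ∀ {m} (es : Vec Term m) j (c : Vec Term (nxV x es)) k →
                 lookup c (blockEmb es j k) ≡ lookup (block es j c) k
  lookup-block (e ∷ es) zero    c k = lookup-take (nx x e) c k
  lookup-block (e ∷ es) (suc j) c k =
    trans (lookup-drop (nx x e) c _) (lookup-block es j (drop (nx x e) c) k)

  lookup-rest : ∀ {m} (es : Vec Term (suc m)) j (c : Vec Term (nxV x es)) k →
                lookup c (restEmb es j k) ≡ lookup (rest es j c) k
  lookup-rest (e ∷ es)      zero    c k = lookup-drop (nx x e) c k
  lookup-rest (e ∷ e' ∷ es) (suc j) c k = begin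
    lookup c ([ _↑ˡ _ , (nx x e ↑ʳ_) ∘ restEmb (e' ∷ es) j ]′ k₁₂)
      ≡⟨ [,]-∘ (lookup c) k₁₂ ⟩
    [ lookup c ∘ (_↑ˡ _) , lookup c ∘ (nx x e ↑ʳ_) ∘ restEmb (e' ∷ es) j ]′ k₁₂
      ≡⟨ [,]-cong (lookup-take (nx x e) c)
                  (λ i → trans (lookup-drop (nx x e) c _) (lookup-rest (e' ∷ es) j c₂ i)) k₁₂ ⟩
    [ lookup (take (nx x e) c) , lookup (rest (e' ∷ es) j c₂) ]′ k₁₂
      ≡⟨ lookup-splitAt (nx x e) (take (nx x e) c) _ k ⟨
    lookup (take (nx x e) c Vec.++ rest (e' ∷ es) j c₂) k
      ∎
    where
    open ≡-Reasoning
    k₁₂ = Fin.splitAt (nx x e) k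
    c₂  = drop (nx x e) c

  vsubsts-block : ∀ {m} (es : Vec Term m) j c →
                  lookup (vsubsts x es c) j ≡ vsubst x (lookup es j) (block es j c)
  vsubsts-block (e ∷ es) zero    c = refl
  vsubsts-block (e ∷ es) (suc j) c = vsubsts-block es j (drop (nx x e) c)

  vsubsts-rest : ∀ {m} (es : Vec Term (suc m)) j c →
                 removeAt (vsubsts x es c) j ≡ vsubsts x (removeAt es j) (rest es j c)
  vsubsts-rest (e ∷ es)      zero    c = refl
  vsubsts-rest (e ∷ e' ∷ es) (suc j) c = cong₂ _∷_
    (cong (vsubst x e) (sym (take-++ (take (nx x e) c) _)))
    (trans (vsubsts-rest (e' ∷ es) j (drop (nx x e) c))
           (cong (vsubsts x (removeAt (e' ∷ es) j)) (sym (drop-++ (take (nx x e) c) _))))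

  blockEmb-injective : ∀ {m} (es : Vec Term m) j → Injective _≡_ _≡_ (blockEmb es j)
  blockEmb-injective (e ∷ es) zero    = ↑ˡ-injective _ _ _
  blockEmb-injective (e ∷ es) (suc j) = blockEmb-injective es j ∘ ↑ʳ-injective (nx x e) _ _

  restEmb-injective : ∀ {m} (es : Vec Term (suc m)) j → Injective _≡_ _≡_ (restEmb es j)
  restEmb-injective (e ∷ es)      zero    = ↑ʳ-injective (nx x e) _ _
  restEmb-injective (e ∷ e' ∷ es) (suc j) =
    [∣]-injective _ _ (↑ˡ-injective _ _ _)
                      (restEmb-injective (e' ∷ es) j ∘ ↑ʳ-injective (nx x e) _ _)
                      (λ i k → ↑ˡ≢↑ʳ i _)

  blockEmb≢restEmb : ∀ {m} (es : Vec Term (suc m)) j k k' → blockEmb es j k ≢ restEmb es j k'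
  blockEmb≢restEmb (e ∷ es)      zero    k k' = ↑ˡ≢↑ʳ k k'
  blockEmb≢restEmb (e ∷ e' ∷ es) (suc j) k k' with Fin.splitAt (nx x e) k'
  ... | inj₁ i = ↑ˡ≢↑ʳ i _ ∘ sym
  ... | inj₂ i = blockEmb≢restEmb (e' ∷ es) j k i ∘ ↑ʳ-injective (nx x e) _ _

glue : ∀ {n₁ n₂ m₁ m₂ m} → (Fin m₁ → Fin m) → (Fin m₂ → Fin m) →
       (Fin n₁ → Fin m₁) → (Fin n₂ → Fin m₂) → Fin (n₁ + n₂) → Fin m
glue e₁ e₂ π₁ π₂ = [ e₁ ∘ π₁ ∣ e₂ ∘ π₂ ]

glue-injective : ∀ {n₁ n₂ m₁ m₂ m} {e₁ : Fin m₁ → Fin m} {e₂ : Fin m₂ → Fin m}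
                 {π₁ : Fin n₁ → Fin m₁} {π₂ : Fin n₂ → Fin m₂} →
                 Injective _≡_ _≡_ e₁ → Injective _≡_ _≡_ e₂ → (∀ k k' → e₁ k ≢ e₂ k') →
                 Injective _≡_ _≡_ π₁ → Injective _≡_ _≡_ π₂ →
                 Injective _≡_ _≡_ (glue e₁ e₂ π₁ π₂)
glue-injective e₁-inj e₂-inj apart π₁-inj π₂-inj =
  [∣]-injective _ _ (π₁-inj ∘ e₁-inj) (π₂-inj ∘ e₂-inj) (λ i j → apart _ _)

Coherent : ∀ {n m} → Vec Term n → Vec Term m → Set
Coherent ds es = ∀ i k → lookup ds i ≍ lookup es k

≍-arguments : ∀ {n m} (ds : Vec Term n) (es : Vec Term m) →
              (∀ i j → lookup (ds Vec.++ es) i ≍ lookup (ds Vec.++ es) j) → Coherent ds es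
≍-arguments {n} {m} ds es coh i k =
  subst₂ _≍_ (lookup-++ˡ ds es i) (lookup-++ʳ ds es k) (coh (i ↑ˡ m) (n ↑ʳ k))

Coherent-rest : ∀ {n m} {d} {ds : Vec Term n} (es : Vec Term (suc m)) →
                Coherent (d ∷ ds) es → ∀ j → Coherent ds (removeAt es j)
Coherent-rest {ds = ds} es coh j i k =
  ≡-subst (lookup ds i ≍_) (sym (lookup-removeAt es j k)) (coh (suc i) (punchIn j k))

-- For coherent s ≍ s', occMaps x s s' lists, once for every isomorphism
-- s ≅ s', the map it induces from the occurrences of x in s to those in s'.
-- Coherence is what excludes an occurrence of x facing a term of another shape.
mutual
  occMaps : ∀ x (s s' : Term) → s ≍ s' → List (Fin (nx x s) → Fin (nx x s'))
  occMaps x (var y) (var .y) var = id ∷ []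
  occMaps x (lam a) (lam a') (lam coh) = occMaps (suc x) a a' coh
  occMaps x (app c ds) (app c' ds') (app coh cohs) =
    cartesianProductWith (glue (_↑ˡ nxV x ds') (nx x c' ↑ʳ_))
      (occMaps x c c' coh) (occMapss x ds ds' (≍-arguments ds ds' cohs))
  occMaps x (inl a) (inl a') (inl coh) = occMaps x a a' coh
  occMaps x (inr a) (inr a') (inr coh) = occMaps x a a' coh
  occMaps x (inl a) (inr a') inl-inr   = []
  occMaps x (inr a) (inl a') inr-inl   = []

  occMapss : ∀ x {n m} (ds : Vec Term n) (es : Vec Term m) → Coherent ds es →
             List (Fin (nxV x ds) → Fin (nxV x es))
  occMapss x []       []       coh = (λ ()) ∷ []
  occMapss x []       (_ ∷ _)  coh = []
  occMapss x (_ ∷ _)  []       coh = []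
  occMapss x (d ∷ ds) (e ∷ es) coh = concatMap (occMapssVia x d ds (e ∷ es) coh) (allFin _)

  occMapssVia : ∀ x {n m} d (ds : Vec Term n) (es : Vec Term (suc m)) → Coherent (d ∷ ds) es →
                (j : Fin (suc m)) → List (Fin (nxV x (d ∷ ds)) → Fin (nxV x es))
  occMapssVia x d ds es coh j =
    cartesianProductWith (glue (blockEmb x es j) (restEmb x es j))
      (occMaps x d (lookup es j) (coh zero j)) (occMapss x ds (removeAt es j) (Coherent-rest es coh j))

mutual
  length-occMaps : ∀ x s s' (coh : s ≍ s') → length (occMaps x s s' coh) ≡ #iso s s'
  length-occMaps x (var y) (var .y) var with y ≟ y
  ... | yes _  = refl
  ... | no y≢y = ⊥-elim (y≢y refl)
  length-occMaps x (lam a) (lam a') (lam coh) = length-occMaps (suc x) a a' coh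
  length-occMaps x (app c ds) (app c' ds') (app coh cohs) =
    trans (length-cartesianProductWith _ (occMaps x c c' coh) _)
          (cong₂ _*_ (length-occMaps x c c' coh) (length-occMapss x ds ds' (≍-arguments ds ds' cohs)))
  length-occMaps x (inl a) (inl a') (inl coh) = length-occMaps x a a' coh
  length-occMaps x (inr a) (inr a') (inr coh) = length-occMaps x a a' coh
  length-occMaps x (inl a) (inr a') inl-inr   = refl
  length-occMaps x (inr a) (inl a') inr-inl   = refl

  length-occMapss : ∀ x {n m} (ds : Vec Term n) (es : Vec Term m) (coh : Coherent ds es) →
                    length (occMapss x ds es coh) ≡ #isos ds es
  length-occMapss x []       []       coh = refl
  length-occMapss x []       (_ ∷ _)  coh = refl
  length-occMapss x (_ ∷ _)  []       coh = refl
  length-occMapss x (d ∷ ds) (e ∷ es) coh =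
    trans (length-concatMap (occMapssVia x d ds (e ∷ es) coh) (allFin _))
          (∑-cong (allFin _) (λ j _ →
            trans (length-cartesianProductWith _ (occMaps x d (lookup (e ∷ es) j) (coh zero j)) _)
                  (cong₂ _*_ (length-occMaps x d _ (coh zero j))
                             (length-occMapss x ds (removeAt (e ∷ es) j) (Coherent-rest (e ∷ es) coh j)))))

mutual
  occMaps-injective : ∀ x s s' (coh : s ≍ s') {π} → π ∈ occMaps x s s' coh → Injective _≡_ _≡_ π
  occMaps-injective x (var y) (var .y) var (here refl) = id
  occMaps-injective x (lam a) (lam a') (lam coh) π∈ = occMaps-injective (suc x) a a' coh π∈
  occMaps-injective x (app c ds) (app c' ds') (app coh cohs) π∈
    with ∈-cartesianProductWith⁻ (glue (_↑ˡ nxV x ds') (nx x c' ↑ʳ_)) (occMaps x c c' coh) _ π∈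
  ... | π₁ , π₂ , π₁∈ , π₂∈ , refl =
    glue-injective (↑ˡ-injective _ _ _) (↑ʳ-injective (nx x c') _ _) ↑ˡ≢↑ʳ
      (occMaps-injective x c c' coh π₁∈) (occMapss-injective x ds ds' (≍-arguments ds ds' cohs) π₂∈)
  occMaps-injective x (inl a) (inl a') (inl coh) π∈ = occMaps-injective x a a' coh π∈
  occMaps-injective x (inr a) (inr a') (inr coh) π∈ = occMaps-injective x a a' coh π∈

  occMapss-injective : ∀ x {n m} (ds : Vec Term n) (es : Vec Term m) (coh : Coherent ds es) {π} →
                       π ∈ occMapss x ds es coh → Injective _≡_ _≡_ π
  occMapss-injective x []       []       coh (here refl) {()}
  occMapss-injective x (d ∷ ds) (e ∷ es) coh π∈
    with find (∈-concatMap⁻ (occMapssVia x d ds (e ∷ es) coh) {xs = allFin _} π∈)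
  ... | j , _ , π∈via
    with ∈-cartesianProductWith⁻ (glue (blockEmb x (e ∷ es) j) (restEmb x (e ∷ es) j))
           (occMaps x d (lookup (e ∷ es) j) (coh zero j)) _ π∈via
  ... | π₁ , π₂ , π₁∈ , π₂∈ , refl =
    glue-injective (blockEmb-injective x (e ∷ es) j) (restEmb-injective x (e ∷ es) j)
      (blockEmb≢restEmb x (e ∷ es) j)
      (occMaps-injective x d _ (coh zero j) π₁∈)
      (occMapss-injective x ds (removeAt (e ∷ es) j) (Coherent-rest (e ∷ es) coh j) π₂∈)

#isosAlong-glue : ∀ {n₁ n₂ m₁ m₂ m} (b : Vec Term (n₁ + n₂)) (c : Vec Term m)
                  (c₁ : Vec Term m₁) (c₂ : Vec Term m₂) {e₁ : Fin m₁ → Fin m} {e₂ : Fin m₂ → Fin m} →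
                  (∀ k → lookup c (e₁ k) ≡ lookup c₁ k) → (∀ k → lookup c (e₂ k) ≡ lookup c₂ k) →
                  ∀ π₁ π₂ → #isosAlong b c (glue e₁ e₂ π₁ π₂)
                          ≡ #isosAlong (take n₁ b) c₁ π₁ * #isosAlong (drop n₁ b) c₂ π₂
#isosAlong-glue {n₁} {n₂} b c c₁ c₂ {e₁} {e₂} c₁-block c₂-block π₁ π₂ =
  trans (∏-[∣] {n₁} {n₂} (λ i k → #iso (lookup b i) (lookup c k)) (e₁ ∘ π₁) (e₂ ∘ π₂))
        (cong₂ _*_ (∏-cong (λ i → cong₂ #iso (lookup-take n₁ b i) (c₁-block (π₁ i))))
                   (∏-cong (λ i → cong₂ #iso (lookup-drop n₁ b i) (c₂-block (π₂ i)))))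

∑-glue : ∀ {n₁ n₂ m₁ m₂ m} (b : Vec Term (n₁ + n₂)) (c : Vec Term m)
         (c₁ : Vec Term m₁) (c₂ : Vec Term m₂) {e₁ : Fin m₁ → Fin m} {e₂ : Fin m₂ → Fin m} →
         (∀ k → lookup c (e₁ k) ≡ lookup c₁ k) → (∀ k → lookup c (e₂ k) ≡ lookup c₂ k) →
         ∀ L₁ L₂ → ∑ L₁ (#isosAlong (take n₁ b) c₁) * ∑ L₂ (#isosAlong (drop n₁ b) c₂)
                 ≡ ∑ (cartesianProductWith (glue e₁ e₂) L₁ L₂) (#isosAlong b c)
∑-glue b c c₁ c₂ c₁-block c₂-block L₁ L₂ =
  trans (∑-product L₁ L₂ _ _)
        (trans (∑-cong L₁ (λ π₁ _ → ∑-cong L₂ (λ π₂ _ →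
                 sym (#isosAlong-glue b c c₁ c₂ c₁-block c₂-block π₁ π₂))))
               (sym (∑-cartesianProductWith _ L₁ L₂ _)))

-- The counting formula: for coherent s ≍ s', an isomorphism s[b/x] ≅ s'[c/x]
-- is an isomorphism s ≅ s' together with, for each occurrence i of x in s,
-- an isomorphism from b_i to the entry of c at the image of i.
mutual
  #iso-vsubst : ∀ x s s' (coh : s ≍ s') (b : Vec Term (nx x s)) (c : Vec Term (nx x s')) →
                #iso (vsubst x s b) (vsubst x s' c) ≡ ∑ (occMaps x s s' coh) (#isosAlong b c)
  #iso-vsubst x (var y) (var .y) var b c with y ≡ᵇ x
  #iso-vsubst x (var y) (var .y) var (b ∷ []) (c ∷ []) | true =
    sym (trans (+-identityʳ _) (*-identityʳ _))
  ... | false with y ≟ y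
  ...   | yes _  = refl
  ...   | no y≢y = ⊥-elim (y≢y refl)
  #iso-vsubst x (lam a) (lam a') (lam coh) b c =
    trans (#iso-vsubst (suc x) a a' coh (Vec.map (shift 0) b) (Vec.map (shift 0) c))
          (∑-cong (occMaps (suc x) a a' coh) (λ π _ → ∏-cong (λ i →
            trans (cong₂ #iso (lookup-map i (shift 0) b) (lookup-map (π i) (shift 0) c))
                  (#iso-shift 0 (lookup b i) (lookup c (π i))))))
  #iso-vsubst x (app c ds) (app c' ds') (app coh cohs) b b' =
    trans (cong₂ _*_ (#iso-vsubst x c c' coh (take (nx x c) b) (take (nx x c') b'))
                     (#iso-vsubsts x ds ds' (≍-arguments ds ds' cohs) (drop (nx x c) b) (drop (nx x c') b')))
          (∑-glue {n₁ = nx x c} b b' (take (nx x c') b') (drop (nx x c') b')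
                  (lookup-take (nx x c') b') (lookup-drop (nx x c') b')
                  (occMaps x c c' coh) (occMapss x ds ds' (≍-arguments ds ds' cohs)))
  #iso-vsubst x (inl a) (inl a') (inl coh) b c = #iso-vsubst x a a' coh b c
  #iso-vsubst x (inr a) (inr a') (inr coh) b c = #iso-vsubst x a a' coh b c
  #iso-vsubst x (inl a) (inr a') inl-inr   b c = refl
  #iso-vsubst x (inr a) (inl a') inr-inl   b c = refl

  #iso-vsubsts : ∀ x {n m} (ds : Vec Term n) (es : Vec Term m) (coh : Coherent ds es)
                 (b : Vec Term (nxV x ds)) (c : Vec Term (nxV x es)) →
                 #isos (vsubsts x ds b) (vsubsts x es c) ≡ ∑ (occMapss x ds es coh) (#isosAlong b c)
  #iso-vsubsts x []       []       coh b c = refl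
  #iso-vsubsts x []       (_ ∷ _)  coh b c = refl
  #iso-vsubsts x (_ ∷ _)  []       coh b c = refl
  #iso-vsubsts x (d ∷ ds) (e ∷ es) coh b c = begin
    ∑ (allFin _) (λ j → #iso (vsubst x d b₁) (lookup (vsubsts x E c) j)
                      * #isos (vsubsts x ds b₂) (removeAt (vsubsts x E c) j))
      ≡⟨ ∑-cong (allFin _) (λ j _ → cong₂ (λ u us → #iso (vsubst x d b₁) u * #isos (vsubsts x ds b₂) us)
                                          (vsubsts-block x E j c) (vsubsts-rest x E j c)) ⟩
    ∑ (allFin _) (λ j → #iso (vsubst x d b₁) (vsubst x (lookup E j) (block x E j c))
                      * #isos (vsubsts x ds b₂) (vsubsts x (removeAt E j) (rest x E j c)))
      ≡⟨ ∑-cong (allFin _) (λ j _ → trans (cong₂ _*_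
           (#iso-vsubst x d (lookup E j) (coh zero j) b₁ (block x E j c))
           (#iso-vsubsts x ds (removeAt E j) (Coherent-rest E coh j) b₂ (rest x E j c)))
           (∑-glue {n₁ = nx x d} b c (block x E j c) (rest x E j c)
                   (lookup-block x E j c) (lookup-rest x E j c)
                   (occMaps x d (lookup E j) (coh zero j))
                   (occMapss x ds (removeAt E j) (Coherent-rest E coh j)))) ⟩
    ∑ (allFin _) (λ j → ∑ (occMapssVia x d ds E coh j) (#isosAlong b c))
      ≡⟨ ∑-concatMap (occMapssVia x d ds E coh) (allFin _) _ ⟨
    ∑ (concatMap (occMapssVia x d ds E coh) (allFin _)) (#isosAlong b c)
      ∎
    where
    open ≡-Reasoning
    E  = e ∷ es
    b₁ = take (nx x d) b
    b₂ = drop (nx x d) b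

-- For an injection π, matching b against its permutations σ·b along π and
-- summing over σ counts the isomorphisms b ≅ b: as σ ranges over 𝔖ₙ, so
-- does σ⁻¹ ∘ π (up to coding π as a permutation ρ).
∑-act-along : ∀ {n} (b : Vec Term n) (π : Fin n → Fin n) → Injective _≡_ _≡_ π →
              ∑ (allPerms n) (λ σ → #isosAlong b (act σ b) π) ≡ #isos b b
∑-act-along {n} b π π-inj = begin
  ∑ (allPerms n) (λ σ → #isosAlong b (act σ b) π)
    ≡⟨ ∑-cong (allPerms n) (λ σ _ → #isosAlong-cong b {act σ b} {b} {π} {apply (f σ)} (lookup-at σ)) ⟩
  ∑ (allPerms n) (#isosAlong b b ∘ apply ∘ f)
    ≡⟨ ∑-perm-reindex f g f∘g g∘f _ ⟩
  ∑ (allPerms n) (#isosAlong b b ∘ apply)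
    ≡⟨ #isos-perms b b ⟨
  #isos b b
    ∎
  where
  open ≡-Reasoning
  ρ : Perm n
  ρ = fromInjection π π-inj
  f g : Perm n → Perm n
  f σ = σ ⁻¹ₚ ∘ₚ ρ
  g τ = ρ ∘ₚ τ ⁻¹ₚ
  apply-f : ∀ σ i → apply (f σ) i ≡ apply⁻¹ σ (π i)
  apply-f σ i = trans (apply-∘ₚ (σ ⁻¹ₚ) ρ i)
                      (trans (apply-⁻¹ₚ σ _) (cong (apply⁻¹ σ) (apply-fromInjection π π-inj i)))
  lookup-at : ∀ σ i → lookup (act σ b) (π i) ≡ lookup b (apply (f σ) i)
  lookup-at σ i = trans (lookup-act⁻¹ σ b (π i)) (cong (lookup b) (sym (apply-f σ i)))
  apply-g : ∀ τ k → apply (g τ) k ≡ π (apply⁻¹ τ k)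
  apply-g τ k = trans (apply-∘ₚ ρ (τ ⁻¹ₚ) k)
                      (trans (apply-fromInjection π π-inj _) (cong π (apply-⁻¹ₚ τ k)))
  f∘g : ∀ τ → f (g τ) ≡ τ
  f∘g τ = perm-ext (f (g τ)) τ (λ i → trans (apply-f (g τ) i) (apply⁻¹-unique (g τ)
            (trans (apply-g τ (apply τ i)) (cong π (apply⁻¹-apply τ i)))))
  g∘f : ∀ σ → g (f σ) ≡ σ
  g∘f σ = perm-ext (g (f σ)) σ (λ k → let j = apply⁻¹ (f σ) k in
    trans (apply-g (f σ) k)
          (trans (sym (apply-apply⁻¹ σ (π j)))
                 (cong (apply σ) (trans (sym (apply-f σ j)) (apply-apply⁻¹ (f σ) k)))))

∑-#iso-permuted : ∀ x r → r ≍ r → (b : Vec Term (nx x r)) →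
                  ∑ (allPerms (nx x r)) (λ σ → #iso (subst r x (toList b)) (subst r x (toList (act σ b))))
                  ≡ #iso r r * #isos b b
∑-#iso-permuted x r coh b = begin
  ∑ perms (λ σ → #iso (subst r x (toList b)) (subst r x (toList (act σ b))))
    ≡⟨ ∑-cong perms (λ σ _ → cong₂ #iso (vsubst-agrees x r b) (vsubst-agrees x r (act σ b))) ⟩
  ∑ perms (λ σ → #iso (vsubst x r b) (vsubst x r (act σ b)))
    ≡⟨ ∑-cong perms (λ σ _ → #iso-vsubst x r r coh b (act σ b)) ⟩
  ∑ perms (λ σ → ∑ maps (#isosAlong b (act σ b)))
    ≡⟨ ∑-swap perms maps (λ σ → #isosAlong b (act σ b)) ⟩
  ∑ maps (λ π → ∑ perms (λ σ → #isosAlong b (act σ b) π))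
    ≡⟨ ∑-cong maps (λ π π∈ → ∑-act-along b π (occMaps-injective x r r coh π∈)) ⟩
  ∑ maps (λ _ → #isos b b)
    ≡⟨ ∑-const maps (#isos b b) ⟩
  length maps * #isos b b
    ≡⟨ cong (_* #isos b b) (length-occMaps x r r coh) ⟩
  #iso r r * #isos b b
    ∎
  where
  open ≡-Reasoning
  perms = allPerms (nx x r)
  maps  = occMaps x r r coh

-- The same identity for a coherent monomial ds: it behaves like the term
-- ⟨λy.y⟩ ds, which has the isomorphisms and substitution instances of ds.
∑-#isos-permuted : ∀ x {n} (ds : Vec Term n) →
                   (∀ i j → lookup (ds Vec.++ ds) i ≍ lookup (ds Vec.++ ds) j) → (b : Vec Term (nxV x ds)) →
                   ∑ (allPerms (nxV x ds)) (λ σ → #isos (substV ds x (toList b)) (substV ds x (toList (act σ b))))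
                   ≡ #isos ds ds * #isos b b
∑-#isos-permuted x ds coh b =
  trans (∑-cong (allPerms (nxV x ds)) (λ σ _ → sym (*-identityˡ _)))
        (trans (∑-#iso-permuted x (app (lam (var 0)) ds) (app (lam var) coh) b)
               (cong (_* #isos b b) (*-identityˡ (#isos ds ds))))

≅ᴿ-term : ∀ {a a'} → (∃ λ ε → ε ∶ a ≅ a') ⇔ term a ≅ᴿ term a'
≅ᴿ-term = mk⇔ (λ (_ , iso) → term iso) (λ { (term iso) → _ , iso })

≅ᴿ-mono : ∀ {n} {ds ds' : Vec Term n} → (∃ λ p → TupIsos ds ds' p) ⇔ mono n ds ≅ᴿ mono n ds'
≅ᴿ-mono = mk⇔ (λ ((σ , αs) , iso) → mono {σ = σ} {αs} iso)
              (λ { (mono {σ = σ} {αs} iso) → (σ , αs) , iso })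

lemma5p19 : (x : ℕ) (r : RExpr) (bs : Vec Term (nxR x r)) → r ≍ᴿ r →
    Σ ℕ λ kS → Σ ℕ λ kr → Σ ℕ λ kb → Σ ℕ λ ks →
      HasCard (Sub x r bs) kS × HasCard (𝔻 r) kr
      × HasCard (𝔻 (mono (nxR x r) bs)) kb
      × HasCard (𝔻 (substR r x (toList bs))) ks
      × ks ≢ 0 × kS * ks ≡ kr * kb
lemma5p19 x (term r) bs (term coh) =
  let t = subst r x (toList bs)
      kS , cardS , countS = count-isomorphic _∶_≅_ #iso isos-card #iso-respects-≅
                              t (λ σ → subst r x (toList (act σ bs)))
  in kS , #iso r r , #isos bs bs , #iso t t ,
     HasCard-cong (λ _ → ≅ᴿ-term) cardS , isos-card r r , tupleIsos-card bs bs , isos-card t t ,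
     HasCard-nonzero (isos-card t t) (≅-refl t) , trans countS (∑-#iso-permuted x r coh bs)
lemma5p19 x (mono n ds) bs (mono coh) =
  let t = substV ds x (toList bs)
      kS , cardS , countS = count-isomorphic (λ w u v → TupIsos u v w) #isos tupleIsos-card
                              #isos-respects-≅ t (λ σ → substV ds x (toList (act σ bs)))
  in kS , #isos ds ds , #isos bs bs , #isos t t ,
     HasCard-cong (λ _ → ≅ᴿ-mono) cardS ,
     tupleIsos-card ds ds , tupleIsos-card bs bs , tupleIsos-card t t ,
     HasCard-nonzero (tupleIsos-card t t) (≅ᵗ-refl t) , trans countS (∑-#isos-permuted x ds coh bs)
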